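{- A square cannot be cut into finitely many rectangles (with pairwise disjoint interiors, whose union is the square) such that each rectangle has ratio of horizontal side length to vertical side length equal to either $1+\sqrt2$ or $\frac{1}{1+\sqrt2}$.
   Context: The sides of the square are horizontal and vertical. The sides of every piece are parallel to the sides of the square. -}

module Defs where

open import Data.Product using (Σ; ∃; _×_; _,_)
open import Data.Sum using (_⊎_)
open import Data.Empty using (⊥)
open import Data.List using (List; length; lookup)
open import Data.Fin using (Fin)
open import Relation.Nullary using (¬_)
open import Relation.Binary.PropositionalEquality using (_≡_; _≢_)

-- The real numbers, axiomatised as a (Dedekind-)complete ordered field.
-- All such structures are isomorphic to ℝ, so quantifying over them
-- is a faithful rendering of a statement about ℝ.
record RealField : Set₁ where
  infixl 6 _+_
  infixl 7 _*_
  infix 4 _<_ _≤_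
  field
    ℝ   : Set
    0ℝ 1ℝ : ℝ
    _+_ _*_ : ℝ → ℝ → ℝ
    -_  : ℝ → ℝ
    _<_ : ℝ → ℝ → Set
    +-assoc : ∀ x y z → (x + y) + z ≡ x + (y + z)
    +-comm  : ∀ x y → x + y ≡ y + x
    +-identityˡ : ∀ x → 0ℝ + x ≡ x
    +-inverseˡ  : ∀ x → (- x) + x ≡ 0ℝ
    *-assoc : ∀ x y z → (x * y) * z ≡ x * (y * z)
    *-comm  : ∀ x y → x * y ≡ y * x
    *-identityˡ : ∀ x → 1ℝ * x ≡ x
    *-inverse : ∀ x → x ≢ 0ℝ → ∃ λ y → y * x ≡ 1ℝ
    distribˡ : ∀ x y z → x * (y + z) ≡ (x * y) + (x * z)
    0≢1 : 0ℝ ≢ 1ℝ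
    <-irrefl : ∀ x → ¬ (x < x)
    <-trans  : ∀ x y z → x < y → y < z → x < z
    <-trichotomy : ∀ x y → x < y ⊎ x ≡ y ⊎ y < x
    +-mono-< : ∀ x y z → x < y → x + z < y + z
    *-pos    : ∀ x y → 0ℝ < x → 0ℝ < y → 0ℝ < x * y

  _≤_ : ℝ → ℝ → Set
  x ≤ y = x < y ⊎ x ≡ y

  _-_ : ℝ → ℝ → ℝ
  x - y = x + (- y)

  IsUpperBound : (ℝ → Set) → ℝ → Set
  IsUpperBound P u = ∀ x → P x → x ≤ u

  field
    completeness : (P : ℝ → Set) → (∃ λ x → P x) → (∃ λ u → IsUpperBound P u) →
                   ∃ λ s → IsUpperBound P s × (∀ u → IsUpperBound P u → s ≤ u)

record Rect (R : RealField) : Set where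
  constructor rect
  open RealField R
  field
    x₀ x₁ y₀ y₁ : ℝ

module _ (R : RealField) where
  open RealField R
  open Rect

  width height : Rect R → ℝ
  width  r = x₁ r - x₀ r
  height r = y₁ r - y₀ r

  Proper : Rect R → Set
  Proper r = x₀ r < x₁ r × y₀ r < y₁ r

  InClosed : Rect R → ℝ → ℝ → Set
  InClosed r p q = (x₀ r ≤ p × p ≤ x₁ r) × (y₀ r ≤ q × q ≤ y₁ r)

  InInterior : Rect R → ℝ → ℝ → Set
  InInterior r p q = (x₀ r < p × p < x₁ r) × (y₀ r < q × q < y₁ r)

  square : ℝ → ℝ → ℝ → Rect R
  square a b d = rect a (a + d) b (b + d)

  Tiles : List (Rect R) → ℝ → ℝ → ℝ → Set
  Tiles rs a b d =
    (∀ i → Proper (lookup rs i))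
    × (∀ i → ∀ p q → InClosed (lookup rs i) p q → InClosed (square a b d) p q)
    × (∀ p q → InClosed (square a b d) p q → ∃ λ i → InClosed (lookup rs i) p q)
    × (∀ (i j : Fin (length rs)) → i ≢ j → ∀ p q →
         ¬ (InInterior (lookup rs i) p q × InInterior (lookup rs j) p q))

  -- horizontal : vertical side ratio is ρ or 1/ρ (stated without division)
  HasRatio : ℝ → Rect R → Set
  HasRatio ρ r = width r ≡ ρ * height r ⊎ ρ * width r ≡ height r

module Submission where

open import Defs
open import Data.Product using (Σ; ∃; _×_; _,_)
open import Data.List using (List; length; lookup)
open import Relation.Nullary using (¬_)
open import Relation.Binary.PropositionalEquality using (_≡_)
open import Data.Product using (proj₁; proj₂)
open import Data.Sum using (_⊎_; inj₁; inj₂)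
open import Relation.Binary.PropositionalEquality
  using (refl; sym; trans; cong; cong₂; subst; subst₂; _≢_; module ≡-Reasoning)

-- Idea (Dehn's method with a field automorphism).  Scale the square to side
-- 1 and give every vertical and horizontal grid line of the tiling an unknown.
-- The actual coordinates solve a linear system with coefficients in ℚ(√2):
-- width 1 and height 1 for the square, and  Δx = (1+√2)Δy  (or the reverse)
-- for every tile.  Gaussian elimination never leaves ℚ(√2), so the system
-- obtained by applying the automorphism √2 ↦ −√2 to all coefficients also has
-- a real solution φ.  For φ the square still has "area" Δφx·Δφy = 1, but each
-- tile has area (1−√2)·(Δφ)² ≤ 0.  Since this area is additive over tilings
-- (expand everything into the cells of the grid), 1 ≤ 0, a contradiction.

-- Arithmetic in ℕ: irrationality of √2.
module SquareRootOfTwo where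

  open import Data.Nat
  open import Data.Nat.Properties
  open import Data.Nat.Induction using (<-rec)
  open import Data.Empty using (⊥-elim)
  open import Function using (_∘_)
  open import Data.Nat.Solver using (module +-*-Solver)
  open +-*-Solver using (solve; _:+_; _:*_; _:=_; con)

  even-or-odd : ∀ n → ∃ λ k → n ≡ k + k ⊎ n ≡ suc (k + k)
  even-or-odd zero = 0 , inj₁ refl
  even-or-odd (suc zero) = 0 , inj₂ refl
  even-or-odd (suc (suc n)) with even-or-odd n
  ... | k , inj₁ refl = suc k , inj₁ (cong suc (sym (+-suc k k)))
  ... | k , inj₂ refl = suc k , inj₂ (cong (suc ∘ suc) (sym (+-suc k k)))

  odd≢even : ∀ x y → suc (x + x) ≢ y + y
  odd≢even x zero ()
  odd≢even zero (suc y) eq = 0≢1+n (trans (cong pred eq) (+-suc y y))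
  odd≢even (suc x) (suc y) eq =
    odd≢even x y (suc-injective (suc-injective
      (trans (cong suc (sym (+-suc (suc x) x))) (trans eq (+-suc (suc y) y)))))

  double-injective : ∀ x y → x + x ≡ y + y → x ≡ y
  double-injective x y eq = *-cancelˡ-≡ x y 2 (trans (cong (x +_) (+-identityʳ x)) (trans eq (cong (y +_) (sym (+-identityʳ y)))))

  odd-square : ∀ k → suc (k + k) * suc (k + k) ≡ suc ((k * k + k * k + (k + k)) + (k * k + k * k + (k + k)))
  odd-square = solve 1 (λ k → (con 1 :+ (k :+ k)) :* (con 1 :+ (k :+ k))
                            := con 1 :+ ((k :* k :+ k :* k :+ (k :+ k)) :+ (k :* k :+ k :* k :+ (k :+ k)))) refl

  even-square : ∀ k → (k + k) * (k + k) ≡ (k * k + k * k) + (k * k + k * k)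
  even-square = solve 1 (λ k → (k :+ k) :* (k :+ k) := (k :* k :+ k :* k) :+ (k :* k :+ k :* k)) refl

  square-even⇒even : ∀ a c → a * a ≡ c + c → ∃ λ k → a ≡ k + k
  square-even⇒even a c eq with even-or-odd a
  ... | k , inj₁ a≡2k = k , a≡2k
  ... | k , inj₂ refl = ⊥-elim (odd≢even (k * k + k * k + (k + k)) c (trans (sym (odd-square k)) eq))

  halve-square : ∀ k c → (k + k) * (k + k) ≡ c + c → k * k + k * k ≡ c
  halve-square k c eq = double-injective _ _ (trans (sym (even-square k)) eq)

  -- √2 is irrational: a² = 2b² forces b = 0.  Infinite descent: a and b are
  -- both even, and (a/2)² = 2(b/2)² is a smaller solution.
  √2-irrational : ∀ a b → a * a ≡ b * b + b * b → b ≡ 0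
  √2-irrational = <-rec (λ a → ∀ b → a * a ≡ b * b + b * b → b ≡ 0) descent
    where
    descent : ∀ a → (∀ {a′} → a′ < a → ∀ b → a′ * a′ ≡ b * b + b * b → b ≡ 0) →
              ∀ b → a * a ≡ b * b + b * b → b ≡ 0
    descent a rec b eq with square-even⇒even a (b * b) eq
    ... | zero , refl with m*n≡0⇒m≡0∨n≡0 b (m+n≡0⇒m≡0 (b * b) (sym eq))
    ...   | inj₁ b≡0 = b≡0
    ...   | inj₂ b≡0 = b≡0
    descent a rec b eq | suc k , refl with square-even⇒even b (suc k * suc k) (sym (halve-square (suc k) (b * b) eq))
    ... | j , refl = cong (λ z → z + z) (rec (m<m+n (suc k) (s≤s z≤n)) j (sym smaller))
      where
      smaller : j * j + j * j ≡ suc k * suc k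
      smaller = halve-square j _ (sym (halve-square (suc k) _ eq))

module OrderedField (R : RealField) where

  open import Data.Nat as ℕ using (ℕ; zero; suc)
  open import Data.Integer as ℤ using (ℤ)
  import Data.Integer.Properties as ℤP
  import Data.Nat.Properties as ℕP
  open import Data.Sign as Sign using (Sign)
  open import Data.Maybe using (Maybe; just; nothing)
  open import Data.Empty using (⊥-elim)
  open import Relation.Nullary using (Dec; yes; no)
  open import Relation.Binary.Consequences using (tri⇒dec≈)
  open import Relation.Binary.PropositionalEquality using (isEquivalence; resp₂)
  open import Relation.Binary.Definitions using (Trichotomous; tri<; tri≈; tri>)
  import Relation.Binary.Construct.StrictToNonStrict _≡_ (RealField._<_ R) as NonStrict
  open import Algebra.Bundles using (CommutativeRing; Ring)
  import Algebra.Solver.Ring.AlmostCommutativeRing as ACR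

  open RealField R public hiding (_-_)

  -- Subtraction with the usual precedence (the _-_ of Defs has none).
  infixl 6 _−_
  _−_ : ℝ → ℝ → ℝ
  x − y = x + - y

  +-inverseʳ : ∀ x → x + (- x) ≡ 0ℝ
  +-inverseʳ x = trans (+-comm x (- x)) (+-inverseˡ x)

  +-identityʳ : ∀ x → x + 0ℝ ≡ x
  +-identityʳ x = trans (+-comm x 0ℝ) (+-identityˡ x)

  *-identityʳ : ∀ x → x * 1ℝ ≡ x
  *-identityʳ x = trans (*-comm x 1ℝ) (*-identityˡ x)

  distribʳ : ∀ x y z → (y + z) * x ≡ (y * x) + (z * x)
  distribʳ x y z = trans (*-comm (y + z) x) (trans (distribˡ x y z) (cong₂ _+_ (*-comm x y) (*-comm x z)))

  -- The field axioms make ℝ a commutative ring, so that the standard ring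
  -- solver (with integer coefficients, see below) applies to it.
  commutativeRing : CommutativeRing _ _
  commutativeRing = record
    { Carrier = ℝ ; _≈_ = _≡_ ; _+_ = _+_ ; _*_ = _*_ ; -_ = -_ ; 0# = 0ℝ ; 1# = 1ℝ
    ; isCommutativeRing = record
      { isRing = record
        { +-isAbelianGroup = record
          { isGroup = record
            { isMonoid = record
              { isSemigroup = record
                { isMagma = record { isEquivalence = isEquivalence ; ∙-cong = cong₂ _+_ }
                ; assoc = +-assoc }
              ; identity = +-identityˡ , +-identityʳ }
            ; inverse = +-inverseˡ , +-inverseʳ
            ; ⁻¹-cong = cong (λ z → - z) }
          ; comm = +-comm }
        ; *-cong = cong₂ _*_
        ; *-assoc = *-assoc
        ; *-identity = *-identityˡ , *-identityʳ
        ; distrib = distribˡ , distribʳ }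
      ; *-comm = *-comm } }

  open import Algebra.Properties.Ring (CommutativeRing.ring commutativeRing) public
    using (-‿involutive; -0#≈0#; -‿+-comm; +-inverseʳ-unique; -‿distribˡ-*)
  open CommutativeRing commutativeRing public using (zeroˡ; zeroʳ)

  open import Algebra.Properties.Semiring.Sum (CommutativeRing.semiring commutativeRing) public
    using (sum; sum-cong-≗; ∑-distrib-+; ∑-comm; *-distribˡ-sum; *-distribʳ-sum)
  open import Algebra.Properties.Semiring.Mult.TCOptimised (CommutativeRing.semiring commutativeRing)
    using (×-homo-+; ×1-homo-*) renaming (_×_ to _times_)

  ι : ℕ → ℝ
  ι n = n times 1ℝ

  ι-+ : ∀ m n → ι (m ℕ.+ n) ≡ ι m + ι n
  ι-+ = ×-homo-+ 1ℝ

  ι-* : ∀ m n → ι (m ℕ.* n) ≡ ι m * ι n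
  ι-* = ×1-homo-*

  ι-suc : ∀ n → ι (suc n) ≡ 1ℝ + ι n
  ι-suc = ι-+ 1

  ⟦_⟧ℤ : ℤ → ℝ
  ⟦ ℤ.+ n ⟧ℤ = ι n
  ⟦ ℤ.-[1+ n ] ⟧ℤ = - ι (suc n)

  ⟦⟧-neg : ∀ z → ⟦ ℤ.- z ⟧ℤ ≡ - ⟦ z ⟧ℤ
  ⟦⟧-neg (ℤ.+ zero) = sym -0#≈0#
  ⟦⟧-neg (ℤ.+ suc n) = refl
  ⟦⟧-neg ℤ.-[1+ n ] = sym (-‿involutive _)

  ⟦⟧-⊖ : ∀ m n → ⟦ m ℤ.⊖ n ⟧ℤ ≡ ι m + - ι n
  ⟦⟧-⊖ m zero = trans (cong ⟦_⟧ℤ (ℤP.⊖-≥ {m} {0} ℕ.z≤n)) (trans (sym (+-identityʳ (ι m))) (cong (ι m +_) (sym -0#≈0#)))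
  ⟦⟧-⊖ zero (suc n) = trans (cong ⟦_⟧ℤ (ℤP.⊖-< {0} {suc n} (ℕ.s≤s ℕ.z≤n))) (sym (+-identityˡ _))
  ⟦⟧-⊖ (suc m) (suc n) = begin
      ⟦ suc m ℤ.⊖ suc n ⟧ℤ          ≡⟨ cong ⟦_⟧ℤ (ℤP.[1+m]⊖[1+n]≡m⊖n m n) ⟩
      ⟦ m ℤ.⊖ n ⟧ℤ                  ≡⟨ ⟦⟧-⊖ m n ⟩
      ι m + - ι n                   ≡⟨ cancel-one (ι m) (ι n) ⟩
      (1ℝ + ι m) + - (1ℝ + ι n)     ≡⟨ sym (cong₂ (λ x y → x + - y) (ι-suc m) (ι-suc n)) ⟩
      ι (suc m) + - ι (suc n)       ∎
    where
    open ≡-Reasoning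
    cancel-one : ∀ x y → x + - y ≡ (1ℝ + x) + - (1ℝ + y)
    cancel-one x y = begin
      x + - y                         ≡⟨ cong (_+ - y) (sym (+-identityˡ x)) ⟩
      (0ℝ + x) + - y                  ≡⟨ cong (λ z → (z + x) + - y) (sym (+-inverseʳ 1ℝ)) ⟩
      ((1ℝ + - 1ℝ) + x) + - y         ≡⟨ cong (_+ - y) (+-assoc 1ℝ (- 1ℝ) x) ⟩
      (1ℝ + (- 1ℝ + x)) + - y         ≡⟨ cong (λ z → (1ℝ + z) + - y) (+-comm (- 1ℝ) x) ⟩
      (1ℝ + (x + - 1ℝ)) + - y         ≡⟨ cong (_+ - y) (sym (+-assoc 1ℝ x (- 1ℝ))) ⟩
      ((1ℝ + x) + - 1ℝ) + - y         ≡⟨ +-assoc (1ℝ + x) (- 1ℝ) (- y) ⟩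
      (1ℝ + x) + (- 1ℝ + - y)         ≡⟨ cong ((1ℝ + x) +_) (-‿+-comm 1ℝ y) ⟩
      (1ℝ + x) + - (1ℝ + y)           ∎

  ⟦⟧-+ : ∀ a b → ⟦ a ℤ.+ b ⟧ℤ ≡ ⟦ a ⟧ℤ + ⟦ b ⟧ℤ
  ⟦⟧-+ (ℤ.+ m) (ℤ.+ n) = ι-+ m n
  ⟦⟧-+ (ℤ.+ m) ℤ.-[1+ n ] = ⟦⟧-⊖ m (suc n)
  ⟦⟧-+ ℤ.-[1+ m ] (ℤ.+ n) = trans (⟦⟧-⊖ n (suc m)) (+-comm _ _)
  ⟦⟧-+ ℤ.-[1+ m ] ℤ.-[1+ n ] = trans (cong (λ k → - ι k) (cong suc (sym (ℕP.+-suc m n))))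
    (trans (cong -_ (ι-+ (suc m) (suc n))) (sym (-‿+-comm (ι (suc m)) (ι (suc n)))))

  -- ⟦ z ⟧ = sign(z)·|z|, which reduces multiplicativity to that of ι.
  ⟦_⟧sign : Sign → ℝ
  ⟦ Sign.+ ⟧sign = 1ℝ
  ⟦ Sign.- ⟧sign = - 1ℝ

  ⟦⟧sign-* : ∀ s t → ⟦ s Sign.* t ⟧sign ≡ ⟦ s ⟧sign * ⟦ t ⟧sign
  ⟦⟧sign-* Sign.+ t = sym (*-identityˡ _)
  ⟦⟧sign-* Sign.- Sign.+ = sym (*-identityʳ _)
  ⟦⟧sign-* Sign.- Sign.- = sym (trans (sym (-‿distribˡ-* 1ℝ (- 1ℝ))) (trans (cong -_ (*-identityˡ _)) (-‿involutive 1ℝ)))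

  negate-by-sign : ∀ x → - x ≡ - 1ℝ * x
  negate-by-sign x = trans (cong -_ (sym (*-identityˡ x))) (-‿distribˡ-* 1ℝ x)

  ⟦⟧-◃ : ∀ s n → ⟦ s ℤ.◃ n ⟧ℤ ≡ ⟦ s ⟧sign * ι n
  ⟦⟧-◃ s zero = sym (zeroʳ _)
  ⟦⟧-◃ Sign.+ (suc n) = sym (*-identityˡ _)
  ⟦⟧-◃ Sign.- (suc n) = negate-by-sign (ι (suc n))

  ⟦⟧-sign-abs : ∀ z → ⟦ z ⟧ℤ ≡ ⟦ ℤ.sign z ⟧sign * ι ℤ.∣ z ∣
  ⟦⟧-sign-abs (ℤ.+ n) = sym (*-identityˡ _)
  ⟦⟧-sign-abs ℤ.-[1+ n ] = negate-by-sign (ι (suc n))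

  ⟦⟧-* : ∀ a b → ⟦ a ℤ.* b ⟧ℤ ≡ ⟦ a ⟧ℤ * ⟦ b ⟧ℤ
  ⟦⟧-* a b = begin
      ⟦ (ℤ.sign a Sign.* ℤ.sign b) ℤ.◃ (ℤ.∣ a ∣ ℕ.* ℤ.∣ b ∣) ⟧ℤ
        ≡⟨ ⟦⟧-◃ (ℤ.sign a Sign.* ℤ.sign b) (ℤ.∣ a ∣ ℕ.* ℤ.∣ b ∣) ⟩
      ⟦ ℤ.sign a Sign.* ℤ.sign b ⟧sign * ι (ℤ.∣ a ∣ ℕ.* ℤ.∣ b ∣)
        ≡⟨ cong₂ _*_ (⟦⟧sign-* (ℤ.sign a) (ℤ.sign b)) (ι-* ℤ.∣ a ∣ ℤ.∣ b ∣) ⟩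
      (sa * sb) * (ia * ib)   ≡⟨ *-assoc sa sb (ia * ib) ⟩
      sa * (sb * (ia * ib))   ≡⟨ cong (sa *_) (sym (*-assoc sb ia ib)) ⟩
      sa * ((sb * ia) * ib)   ≡⟨ cong (λ z → sa * (z * ib)) (*-comm sb ia) ⟩
      sa * ((ia * sb) * ib)   ≡⟨ cong (sa *_) (*-assoc ia sb ib) ⟩
      sa * (ia * (sb * ib))   ≡⟨ sym (*-assoc sa ia (sb * ib)) ⟩
      (sa * ia) * (sb * ib)   ≡⟨ sym (cong₂ _*_ (⟦⟧-sign-abs a) (⟦⟧-sign-abs b)) ⟩
      ⟦ a ⟧ℤ * ⟦ b ⟧ℤ         ∎
    where
    open ≡-Reasoning
    sa sb ia ib : ℝ
    sa = ⟦ ℤ.sign a ⟧sign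
    sb = ⟦ ℤ.sign b ⟧sign
    ia = ι ℤ.∣ a ∣
    ib = ι ℤ.∣ b ∣

  ℤ-morphism : Ring.rawRing ℤP.+-*-ring ACR.-Raw-AlmostCommutative⟶ ACR.fromCommutativeRing commutativeRing
  ℤ-morphism = record
    { ⟦_⟧ = ⟦_⟧ℤ ; +-homo = ⟦⟧-+ ; *-homo = ⟦⟧-* ; -‿homo = ⟦⟧-neg ; 0-homo = refl ; 1-homo = refl }

  ℤ-coefficients? : ∀ a b → Maybe (⟦ a ⟧ℤ ≡ ⟦ b ⟧ℤ)
  ℤ-coefficients? a b with a ℤ.≟ b
  ... | yes refl = just refl
  ... | no _ = nothing

  open import Algebra.Solver.Ring (Ring.rawRing ℤP.+-*-ring) (ACR.fromCommutativeRing commutativeRing)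
    ℤ-morphism ℤ-coefficients? public using (solve; _:=_; con; _:+_; _:*_; :-_; _:-_)

  two : ℝ
  two = 1ℝ + 1ℝ

  <-asym : ∀ {x y} → x < y → ¬ (y < x)
  <-asym {x} {y} p q = <-irrefl x (<-trans x y x p q)

  <⇒≢ : ∀ {x y} → x < y → x ≢ y
  <⇒≢ {x} p refl = <-irrefl x p

  <⇒¬≥ : ∀ {x y} → x < y → ¬ (y ≤ x)
  <⇒¬≥ p (inj₁ q) = <-asym p q
  <⇒¬≥ p (inj₂ refl) = <⇒≢ p refl

  compare : Trichotomous _≡_ _<_
  compare x y with <-trichotomy x y
  ... | inj₁ x<y = tri< x<y (<⇒≢ x<y) (<-asym x<y)
  ... | inj₂ (inj₁ x≡y) = tri≈ (λ x<y → <⇒≢ x<y x≡y) x≡y (λ y<x → <⇒≢ y<x (sym x≡y))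
  ... | inj₂ (inj₂ y<x) = tri> (<-asym y<x) (λ x≡y → <⇒≢ y<x (sym x≡y)) y<x

  _≟_ : ∀ x y → Dec (x ≡ y)
  _≟_ = tri⇒dec≈ compare

  _≤?_ : ∀ x y → Dec (x ≤ y)
  _≤?_ = NonStrict.decidable′ compare

  ≤-refl : ∀ {x} → x ≤ x
  ≤-refl = inj₂ refl

  ≤-trans : ∀ {x y z} → x ≤ y → y ≤ z → x ≤ z
  ≤-trans = NonStrict.trans isEquivalence (resp₂ _<_) (λ {x} {y} {z} → <-trans x y z)

  <-≤-trans : ∀ {x y z} → x < y → y ≤ z → x < z
  <-≤-trans = NonStrict.<-≤-trans (λ {x} {y} {z} → <-trans x y z) (proj₁ (resp₂ _<_))

  ≤-<-trans : ∀ {x y z} → x ≤ y → y < z → x < z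
  ≤-<-trans = NonStrict.≤-<-trans sym (λ {x} {y} {z} → <-trans x y z) (proj₂ (resp₂ _<_))

  +-monoʳ-< : ∀ {x y} z → x < y → z + x < z + y
  +-monoʳ-< {x} {y} z p = subst₂ _<_ (+-comm x z) (+-comm y z) (+-mono-< x y z p)

  +-mono-≤ : ∀ {x y} z → x ≤ y → x + z ≤ y + z
  +-mono-≤ {x} {y} z (inj₁ p) = inj₁ (+-mono-< x y z p)
  +-mono-≤ z (inj₂ refl) = ≤-refl

  sub-pos : ∀ {x y} → x < y → 0ℝ < y − x
  sub-pos {x} {y} p = subst (_< y − x) (+-inverseʳ x) (+-mono-< x y (- x) p)

  pos-sub : ∀ {x y} → 0ℝ < y − x → x < y
  pos-sub {x} {y} p = subst₂ _<_ (+-identityˡ x) (solve 2 (λ x y → (y :- x) :+ x := y) refl x y) (+-mono-< 0ℝ (y − x) x p)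

  neg-pos : ∀ {x} → x < 0ℝ → 0ℝ < - x
  neg-pos {x} p = subst₂ _<_ (+-inverseʳ x) (+-identityˡ (- x)) (+-mono-< x 0ℝ (- x) p)

  pos-neg : ∀ {x} → 0ℝ < x → - x < 0ℝ
  pos-neg {x} p = subst₂ _<_ (+-identityˡ (- x)) (+-inverseʳ x) (+-mono-< 0ℝ x (- x) p)

  pos-add : ∀ {x y} → 0ℝ < x → 0ℝ < y → 0ℝ < x + y
  pos-add {x} {y} p q = <-trans 0ℝ x (x + y) p (subst (_< x + y) (+-identityʳ x) (+-monoʳ-< x q))

  nonpos-add : ∀ {x y} → x ≤ 0ℝ → y ≤ 0ℝ → x + y ≤ 0ℝ
  nonpos-add {x} {y} p q = ≤-trans (+-mono-≤ y p) (subst (_≤ 0ℝ) (sym (+-identityˡ y)) q)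

  square-nonneg : ∀ x → 0ℝ ≤ x * x
  square-nonneg x with compare x 0ℝ
  ... | tri< x<0 _ _ = inj₁ (subst (0ℝ <_) (solve 1 (λ x → (:- x) :* (:- x) := x :* x) refl x) (*-pos _ _ (neg-pos x<0) (neg-pos x<0)))
  ... | tri≈ _ refl _ = inj₂ (sym (zeroˡ 0ℝ))
  ... | tri> _ _ 0<x = inj₁ (*-pos _ _ 0<x 0<x)

  0<1 : 0ℝ < 1ℝ
  0<1 = strict (square-nonneg 1ℝ)
    where
    strict : 0ℝ ≤ 1ℝ * 1ℝ → 0ℝ < 1ℝ
    strict (inj₁ p) = subst (0ℝ <_) (*-identityˡ 1ℝ) p
    strict (inj₂ e) = ⊥-elim (0≢1 (trans e (*-identityˡ 1ℝ)))

  1<2 : 1ℝ < two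
  1<2 = subst₂ _<_ (+-identityˡ 1ℝ) refl (+-mono-< 0ℝ 1ℝ 1ℝ 0<1)

  *-monoˡ-< : ∀ {c x y} → 0ℝ < c → x < y → c * x < c * y
  *-monoˡ-< {c} {x} {y} pc p = pos-sub (subst (0ℝ <_) (solve 3 (λ c x y → c :* (y :- x) := c :* y :- c :* x) refl c x y) (*-pos _ _ pc (sub-pos p)))

  neg-*-nonneg : ∀ {x y} → x < 0ℝ → 0ℝ ≤ y → x * y ≤ 0ℝ
  neg-*-nonneg {x} {y} p (inj₁ q) = inj₁ (subst (_< 0ℝ) (solve 2 (λ x y → :- ((:- x) :* y) := x :* y) refl x y) (pos-neg (*-pos _ _ (neg-pos p) q)))
  neg-*-nonneg {x} p (inj₂ refl) = inj₂ (zeroʳ x)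

  *-cancelˡ-0 : ∀ x y → x ≢ 0ℝ → x * y ≡ 0ℝ → y ≡ 0ℝ
  *-cancelˡ-0 x y x≢0 xy≡0 with *-inverse x x≢0
  ... | x⁻¹ , x⁻¹x≡1 = begin
      y              ≡⟨ sym (*-identityˡ y) ⟩
      1ℝ * y         ≡⟨ cong (_* y) (sym x⁻¹x≡1) ⟩
      (x⁻¹ * x) * y  ≡⟨ *-assoc x⁻¹ x y ⟩
      x⁻¹ * (x * y)  ≡⟨ cong (x⁻¹ *_) xy≡0 ⟩
      x⁻¹ * 0ℝ       ≡⟨ zeroʳ x⁻¹ ⟩
      0ℝ             ∎
    where open ≡-Reasoning

  *-nonzero : ∀ x y → x ≢ 0ℝ → y ≢ 0ℝ → x * y ≢ 0ℝ
  *-nonzero x y x≢0 y≢0 xy≡0 = y≢0 (*-cancelˡ-0 x y x≢0 xy≡0)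

  invertible⇒nonzero : ∀ {x x⁻¹} → x⁻¹ * x ≡ 1ℝ → x ≢ 0ℝ
  invertible⇒nonzero {x} {x⁻¹} e refl = 0≢1 (trans (sym (zeroʳ x⁻¹)) e)

  -- ⟦_⟧ℤ is injective, because ι(n+1) > 0.
  ι-pos : ∀ n → 0ℝ < ι (suc n)
  ι-pos zero = 0<1
  ι-pos (suc n) = subst (0ℝ <_) (sym (ι-suc (suc n))) (pos-add 0<1 (ι-pos n))

  ⟦⟧-zero : ∀ z → ⟦ z ⟧ℤ ≡ 0ℝ → z ≡ ℤ.0ℤ
  ⟦⟧-zero (ℤ.+ zero) e = refl
  ⟦⟧-zero (ℤ.+ suc n) e = ⊥-elim (<⇒≢ (ι-pos n) (sym e))
  ⟦⟧-zero ℤ.-[1+ n ] e = ⊥-elim (<⇒≢ (pos-neg (ι-pos n)) e)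

  ⟦⟧-injective : ∀ a b → ⟦ a ⟧ℤ ≡ ⟦ b ⟧ℤ → a ≡ b
  ⟦⟧-injective a b e = ℤP.i-j≡0⇒i≡j a b (⟦⟧-zero (a ℤ.- b) difference≡0)
    where
    difference≡0 : ⟦ a ℤ.- b ⟧ℤ ≡ 0ℝ
    difference≡0 = trans (⟦⟧-+ a (ℤ.- b)) (trans (cong (⟦ a ⟧ℤ +_) (⟦⟧-neg b)) (trans (cong (_− ⟦ b ⟧ℤ) e) (+-inverseʳ _)))

-- The field ℚ(s) for a real s with s² = 2, and its conjugation s ↦ −s.
module QuadraticField (R : RealField) (s : RealField.ℝ R) (s²≡2 : RealField._*_ R s s ≡ OrderedField.two R) where

  open import Data.Nat as ℕ using ()
  open import Data.Integer as ℤ using (ℤ)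
  import Data.Integer.Properties as ℤP
  open SquareRootOfTwo using (√2-irrational)
  open OrderedField R

  IsInt : ℝ → Set
  IsInt x = ∃ λ z → x ≡ ⟦ z ⟧ℤ

  int-+ : ∀ {x y} → IsInt x → IsInt y → IsInt (x + y)
  int-+ (a , refl) (b , refl) = a ℤ.+ b , sym (⟦⟧-+ a b)

  int-* : ∀ {x y} → IsInt x → IsInt y → IsInt (x * y)
  int-* (a , refl) (b , refl) = a ℤ.* b , sym (⟦⟧-* a b)

  int-neg : ∀ {x} → IsInt x → IsInt (- x)
  int-neg (a , refl) = ℤ.- a , sym (⟦⟧-neg a)

  int-0 : IsInt 0ℝ
  int-0 = ℤ.0ℤ , refl

  int-1 : IsInt 1ℝ
  int-1 = ℤ.1ℤ , refl

  int-2 : IsInt two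
  int-2 = int-+ int-1 int-1

  square-abs : ∀ b → b ℤ.* b ≡ ℤ.+ (ℤ.∣ b ∣ ℕ.* ℤ.∣ b ∣)
  square-abs (ℤ.+ n) = ℤP.+◃n≡+n _
  square-abs ℤ.-[1+ n ] = ℤP.+◃n≡+n _

  -- If t² = 2, then 1 and t are linearly independent over ℤ (√2 ∉ ℚ).
  int-independent : ∀ {t A B} → t * t ≡ two → IsInt A → IsInt B → A + B * t ≡ 0ℝ → A ≡ 0ℝ × B ≡ 0ℝ
  int-independent {t} {A} {B} t²≡2 (a , refl) (b , refl) A+Bt≡0 = A≡0 , B≡0
    where
    open ≡-Reasoning
    A≡-Bt : A ≡ - (B * t)
    A≡-Bt = +-inverseʳ-unique (B * t) A (trans (+-comm (B * t) A) A+Bt≡0)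
    A²≡2B² : A * A ≡ B * B + B * B
    A²≡2B² = begin
      A * A                       ≡⟨ cong₂ _*_ A≡-Bt A≡-Bt ⟩
      (- (B * t)) * (- (B * t))   ≡⟨ solve 2 (λ B t → (:- (B :* t)) :* (:- (B :* t)) := B :* B :* (t :* t)) refl B t ⟩
      B * B * (t * t)             ≡⟨ cong (B * B *_) t²≡2 ⟩
      B * B * two                 ≡⟨ solve 1 (λ B → B :* B :* (con ℤ.1ℤ :+ con ℤ.1ℤ) := B :* B :+ B :* B) refl B ⟩
      B * B + B * B               ∎
    in-ℤ : a ℤ.* a ≡ b ℤ.* b ℤ.+ b ℤ.* b
    in-ℤ = ⟦⟧-injective _ _ (begin
      ⟦ a ℤ.* a ⟧ℤ                ≡⟨ ⟦⟧-* a a ⟩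
      A * A                       ≡⟨ A²≡2B² ⟩
      B * B + B * B               ≡⟨ sym (cong₂ _+_ (⟦⟧-* b b) (⟦⟧-* b b)) ⟩
      ⟦ b ℤ.* b ⟧ℤ + ⟦ b ℤ.* b ⟧ℤ ≡⟨ sym (⟦⟧-+ (b ℤ.* b) (b ℤ.* b)) ⟩
      ⟦ b ℤ.* b ℤ.+ b ℤ.* b ⟧ℤ    ∎)
    in-ℕ : ℤ.∣ a ∣ ℕ.* ℤ.∣ a ∣ ≡ ℤ.∣ b ∣ ℕ.* ℤ.∣ b ∣ ℕ.+ ℤ.∣ b ∣ ℕ.* ℤ.∣ b ∣
    in-ℕ = ℤP.+-injective (trans (sym (square-abs a)) (trans in-ℤ (cong₂ ℤ._+_ (square-abs b) (square-abs b))))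
    B≡0 : B ≡ 0ℝ
    B≡0 = cong ⟦_⟧ℤ (ℤP.∣i∣≡0⇒i≡0 {b} (√2-irrational ℤ.∣ a ∣ ℤ.∣ b ∣ in-ℕ))
    A≡0 : A ≡ 0ℝ
    A≡0 = trans A≡-Bt (trans (cong (λ z → - (z * t)) B≡0) (trans (cong -_ (zeroˡ t)) -0#≈0#))

  Form : ℝ → ℝ → ℝ → ℝ → ℝ → Set
  Form t x A B C = C * x ≡ A + B * t

  form-zero : ∀ {t x A B C} → C ≢ 0ℝ → Form t x A B C → A ≡ 0ℝ → B ≡ 0ℝ → x ≡ 0ℝ
  form-zero {t} {x} {A} {B} {C} C≢0 f refl refl = *-cancelˡ-0 C x C≢0 (trans f (trans (+-identityˡ _) (zeroˡ t)))

  form-add : ∀ {t x A B C x′ A′ B′ C′} → Form t x A B C → Form t x′ A′ B′ C′ →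
             Form t (x + x′) (C′ * A + C * A′) (C′ * B + C * B′) (C * C′)
  form-add {t} {x} {A} {B} {C} {x′} {A′} {B′} {C′} f f′ = begin
      (C * C′) * (x + x′)                    ≡⟨ solve 4 (λ C C′ x x′ → (C :* C′) :* (x :+ x′) := C′ :* (C :* x) :+ C :* (C′ :* x′)) refl C C′ x x′ ⟩
      C′ * (C * x) + C * (C′ * x′)           ≡⟨ cong₂ (λ u v → C′ * u + C * v) f f′ ⟩
      C′ * (A + B * t) + C * (A′ + B′ * t)   ≡⟨ solve 7 (λ C C′ A B A′ B′ t → C′ :* (A :+ B :* t) :+ C :* (A′ :+ B′ :* t) := (C′ :* A :+ C :* A′) :+ (C′ :* B :+ C :* B′) :* t) refl C C′ A B A′ B′ t ⟩
      (C′ * A + C * A′) + (C′ * B + C * B′) * t ∎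
    where open ≡-Reasoning

  form-neg : ∀ {t x A B C} → Form t x A B C → Form t (- x) (- A) (- B) C
  form-neg {t} {x} {A} {B} {C} f = begin
      C * (- x)          ≡⟨ solve 2 (λ C x → C :* (:- x) := :- (C :* x)) refl C x ⟩
      - (C * x)          ≡⟨ cong -_ f ⟩
      - (A + B * t)      ≡⟨ solve 3 (λ A B t → :- (A :+ B :* t) := (:- A) :+ (:- B) :* t) refl A B t ⟩
      (- A) + (- B) * t  ∎
    where open ≡-Reasoning

  form-mul : ∀ {t x A B C x′ A′ B′ C′} → t * t ≡ two → Form t x A B C → Form t x′ A′ B′ C′ →
             Form t (x * x′) (A * A′ + B * B′ * two) (A * B′ + A′ * B) (C * C′)
  form-mul {t} {x} {A} {B} {C} {x′} {A′} {B′} {C′} t²≡2 f f′ = begin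
      (C * C′) * (x * x′)            ≡⟨ solve 4 (λ C C′ x x′ → (C :* C′) :* (x :* x′) := (C :* x) :* (C′ :* x′)) refl C C′ x x′ ⟩
      (C * x) * (C′ * x′)            ≡⟨ cong₂ _*_ f f′ ⟩
      (A + B * t) * (A′ + B′ * t)    ≡⟨ solve 5 (λ A B A′ B′ t → (A :+ B :* t) :* (A′ :+ B′ :* t) := (A :* A′ :+ B :* B′ :* (t :* t)) :+ (A :* B′ :+ A′ :* B) :* t) refl A B A′ B′ t ⟩
      (A * A′ + B * B′ * (t * t)) + (A * B′ + A′ * B) * t ≡⟨ cong (λ z → (A * A′ + B * B′ * z) + (A * B′ + A′ * B) * t) t²≡2 ⟩
      (A * A′ + B * B′ * two) + (A * B′ + A′ * B) * t     ∎
    where open ≡-Reasoning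

  -- 1/(A + Bt) = (A − Bt)/(A² − 2B²).
  form-inv : ∀ {t x A B C x⁻¹} → t * t ≡ two → Form t x A B C → x⁻¹ * x ≡ 1ℝ →
             Form t x⁻¹ (C * A) (- (C * B)) (A * A − B * B * two)
  form-inv {t} {x} {A} {B} {C} {x⁻¹} t²≡2 f x⁻¹x≡1 = begin
      (A * A − B * B * two) * x⁻¹               ≡⟨ cong (λ z → (A * A − B * B * z) * x⁻¹) (sym t²≡2) ⟩
      (A * A − B * B * (t * t)) * x⁻¹           ≡⟨ solve 4 (λ A B t y → (A :* A :- B :* B :* (t :* t)) :* y := (A :+ (:- B) :* t) :* ((A :+ B :* t) :* y)) refl A B t x⁻¹ ⟩
      (A + (- B) * t) * ((A + B * t) * x⁻¹)     ≡⟨ cong (λ z → (A + (- B) * t) * (z * x⁻¹)) (sym f) ⟩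
      (A + (- B) * t) * ((C * x) * x⁻¹)         ≡⟨ solve 6 (λ A B t C x y → (A :+ (:- B) :* t) :* ((C :* x) :* y) := (C :* A :+ (:- (C :* B)) :* t) :* (y :* x)) refl A B t C x x⁻¹ ⟩
      (C * A + (- (C * B)) * t) * (x⁻¹ * x)     ≡⟨ cong ((C * A + (- (C * B)) * t) *_) x⁻¹x≡1 ⟩
      (C * A + (- (C * B)) * t) * 1ℝ            ≡⟨ *-identityʳ _ ⟩
      C * A + (- (C * B)) * t                   ∎
    where open ≡-Reasoning

  -- (−s)² = 2 as well, so the form lemmas apply to both s and −s.
  -s²≡2 : (- s) * (- s) ≡ two
  -s²≡2 = trans (solve 1 (λ s → (:- s) :* (:- s) := s :* s) refl s) s²≡2

  -- Conj p q:  p = (A + Bs)/C  and  q = (A − Bs)/C  for integers A, B, C ≠ 0,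
  -- i.e. p ∈ ℚ(s) and q is its image under the automorphism s ↦ −s.
  record Conj (p q : ℝ) : Set where
    constructor conj
    field
      {A B C} : ℝ
      A-int : IsInt A
      B-int : IsInt B
      C-int : IsInt C
      C≢0 : C ≢ 0ℝ
      form₊ : Form s p A B C
      form₋ : Form (- s) q A B C

  conj-sym : ∀ {p q} → Conj p q → Conj q p
  conj-sym {p} {q} (conj {A} {B} {C} zA zB zC C≢0 f₊ f₋) =
    conj zA (int-neg zB) zC C≢0 (trans f₋ (cong (A +_) (move-sign B s))) (trans f₊ (cong (A +_) (neg-neg B s)))
    where
    move-sign : ∀ x y → x * (- y) ≡ (- x) * y
    move-sign x y = solve 2 (λ x y → x :* (:- y) := (:- x) :* y) refl x y
    neg-neg : ∀ x y → x * y ≡ (- x) * (- y)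
    neg-neg x y = solve 2 (λ x y → x :* y := (:- x) :* (:- y)) refl x y

  conj-zero : ∀ {p q} → Conj p q → p ≡ 0ℝ → q ≡ 0ℝ
  conj-zero (conj zA zB zC C≢0 f₊ f₋) p≡0 with int-independent s²≡2 zA zB (trans (sym f₊) (trans (cong (_ *_) p≡0) (zeroʳ _)))
  ... | A≡0 , B≡0 = form-zero C≢0 f₋ A≡0 B≡0

  conj-0 : Conj 0ℝ 0ℝ
  conj-0 = conj int-0 int-0 int-1 (λ 1≡0 → 0≢1 (sym 1≡0)) (zero-form s) (zero-form (- s))
    where
    zero-form : ∀ t → Form t 0ℝ 0ℝ 0ℝ 1ℝ
    zero-form t = solve 1 (λ t → con ℤ.1ℤ :* con ℤ.0ℤ := con ℤ.0ℤ :+ con ℤ.0ℤ :* t) refl t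

  conj-1 : Conj 1ℝ 1ℝ
  conj-1 = conj int-1 int-0 int-1 (λ 1≡0 → 0≢1 (sym 1≡0)) (one-form s) (one-form (- s))
    where
    one-form : ∀ t → Form t 1ℝ 1ℝ 0ℝ 1ℝ
    one-form t = solve 1 (λ t → con ℤ.1ℤ :* con ℤ.1ℤ := con ℤ.1ℤ :+ con ℤ.0ℤ :* t) refl t

  conj-1+s : Conj (1ℝ + s) (1ℝ + - s)
  conj-1+s = conj int-1 int-1 int-1 (λ 1≡0 → 0≢1 (sym 1≡0)) (one-plus-form s) (one-plus-form (- s))
    where
    one-plus-form : ∀ t → Form t (1ℝ + t) 1ℝ 1ℝ 1ℝ
    one-plus-form t = solve 1 (λ t → con ℤ.1ℤ :* (con ℤ.1ℤ :+ t) := con ℤ.1ℤ :+ con ℤ.1ℤ :* t) refl t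

  conj-+ : ∀ {p q p′ q′} → Conj p q → Conj p′ q′ → Conj (p + p′) (q + q′)
  conj-+ (conj zA zB zC C≢0 f₊ f₋) (conj zA′ zB′ zC′ C′≢0 f₊′ f₋′) =
    conj (int-+ (int-* zC′ zA) (int-* zC zA′)) (int-+ (int-* zC′ zB) (int-* zC zB′)) (int-* zC zC′)
         (*-nonzero _ _ C≢0 C′≢0) (form-add f₊ f₊′) (form-add f₋ f₋′)

  conj-neg : ∀ {p q} → Conj p q → Conj (- p) (- q)
  conj-neg (conj zA zB zC C≢0 f₊ f₋) = conj (int-neg zA) (int-neg zB) zC C≢0 (form-neg f₊) (form-neg f₋)

  conj-* : ∀ {p q p′ q′} → Conj p q → Conj p′ q′ → Conj (p * p′) (q * q′)
  conj-* (conj zA zB zC C≢0 f₊ f₋) (conj zA′ zB′ zC′ C′≢0 f₊′ f₋′) =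
    conj (int-+ (int-* zA zA′) (int-* (int-* zB zB′) int-2)) (int-+ (int-* zA zB′) (int-* zA′ zB)) (int-* zC zC′)
         (*-nonzero _ _ C≢0 C′≢0) (form-mul s²≡2 f₊ f₊′) (form-mul -s²≡2 f₋ f₋′)

  conj-inv : ∀ {p q p⁻¹ q⁻¹} → Conj p q → p⁻¹ * p ≡ 1ℝ → q⁻¹ * q ≡ 1ℝ → Conj p⁻¹ q⁻¹
  conj-inv {p} {q} {p⁻¹} {q⁻¹} (conj {A} {B} {C} zA zB zC C≢0 f₊ f₋) p⁻¹p≡1 q⁻¹q≡1 =
    conj (int-* zC zA) (int-neg (int-* zC zB)) (int-+ (int-* zA zA) (int-neg (int-* (int-* zB zB) int-2)))
         norm≢0 (form-inv s²≡2 f₊ p⁻¹p≡1) (form-inv -s²≡2 f₋ q⁻¹q≡1)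
    where
    -- The norm A² − 2B² = (A + Bs)(A − Bs) vanishes only if A = B = 0.
    norm-factors : A * A − B * B * two ≡ (A + B * s) * (A + B * (- s))
    norm-factors = trans (cong (λ z → A * A − B * B * z) (sym s²≡2))
      (solve 3 (λ A B s → A :* A :- B :* B :* (s :* s) := (A :+ B :* s) :* (A :+ B :* (:- s))) refl A B s)
    A+Bs≢0 : A + B * s ≢ 0ℝ
    A+Bs≢0 A+Bs≡0 = *-nonzero C p C≢0 (invertible⇒nonzero p⁻¹p≡1) (trans f₊ A+Bs≡0)
    norm≢0 : A * A − B * B * two ≢ 0ℝ
    norm≢0 norm≡0 with int-independent -s²≡2 zA zB (*-cancelˡ-0 _ _ A+Bs≢0 (trans (sym norm-factors) norm≡0))
    ... | A≡0 , B≡0 = A+Bs≢0 (trans (cong₂ (λ a b → a + b * s) A≡0 B≡0) (trans (+-identityˡ _) (zeroˡ s)))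

  -- An element of ℚ(s) together with its conjugate: the images of one element
  -- under the two real embeddings s ↦ s and s ↦ −s of ℚ(√2).
  record QS : Set where
    constructor qs
    field
      σ₊ σ₋ : ℝ
      paired : Conj σ₊ σ₋

  open QS public

  𝟘 𝟙 ρ : QS
  𝟘 = qs 0ℝ 0ℝ conj-0
  𝟙 = qs 1ℝ 1ℝ conj-1
  ρ = qs (1ℝ + s) (1ℝ + - s) conj-1+s

  infixl 6 _⊕_
  infixl 7 _⊗_
  _⊕_ _⊗_ : QS → QS → QS
  a ⊕ b = qs (σ₊ a + σ₊ b) (σ₋ a + σ₋ b) (conj-+ (paired a) (paired b))
  a ⊗ b = qs (σ₊ a * σ₊ b) (σ₋ a * σ₋ b) (conj-* (paired a) (paired b))

  ⊝_ : QS → QS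
  ⊝ a = qs (- σ₊ a) (- σ₋ a) (conj-neg (paired a))

  σ₊≡0⇒σ₋≡0 : ∀ a → σ₊ a ≡ 0ℝ → σ₋ a ≡ 0ℝ
  σ₊≡0⇒σ₋≡0 a = conj-zero (paired a)

  σ₋≡0⇒σ₊≡0 : ∀ a → σ₋ a ≡ 0ℝ → σ₊ a ≡ 0ℝ
  σ₋≡0⇒σ₊≡0 a = conj-zero (conj-sym (paired a))

  record Inverse (a : QS) : Set where
    field
      element : QS
      inverse₊ : σ₊ element * σ₊ a ≡ 1ℝ
      inverse₋ : σ₋ element * σ₋ a ≡ 1ℝ

  invert : ∀ a → σ₊ a ≢ 0ℝ → Inverse a
  invert a σ₊a≢0 with *-inverse (σ₊ a) σ₊a≢0 | *-inverse (σ₋ a) (λ σ₋a≡0 → σ₊a≢0 (σ₋≡0⇒σ₊≡0 a σ₋a≡0))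
  ... | x , x·a≡1 | y , y·a≡1 = record { element = qs x y (conj-inv (paired a) x·a≡1 y·a≡1) ; inverse₊ = x·a≡1 ; inverse₋ = y·a≡1 }

-- Linear systems with coefficients in ℚ(s): if such a system has a real
-- solution, then the conjugate system (all coefficients conjugated) also has
-- a real solution.  Proof by Gaussian elimination, which only ever forms
-- ℚ(s)-combinations of the coefficients and so commutes with conjugation.
module ConjugateSystems (R : RealField) (s : RealField.ℝ R) (s²≡2 : RealField._*_ R s s ≡ OrderedField.two R) where

  open import Data.Nat using (ℕ; zero; suc)
  open import Data.Fin using (Fin; zero; suc)
  open import Data.Fin.Properties using (any?)
  open import Data.Integer as ℤ using ()
  open import Data.Vec.Functional using (_∷_)
  open import Function using (_∘_)
  open import Relation.Nullary using (yes; no)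
  open import Relation.Nullary.Decidable using (¬?; decidable-stable)
  open OrderedField R
  open QuadraticField R s s²≡2

  dot : ∀ {N} → (Fin N → ℝ) → (Fin N → ℝ) → ℝ
  dot c v = sum (λ j → c j * v j)

  dot-linear : ∀ {N} (c c₀ : Fin N → ℝ) k v → dot (λ j → c j − k * c₀ j) v ≡ dot c v − k * dot c₀ v
  dot-linear c c₀ k v = begin
    dot (λ j → c j − k * c₀ j) v                        ≡⟨ sum-cong-≗ (λ j → solve 4 (λ c c₀ k v → (c :- k :* c₀) :* v := c :* v :+ (:- k) :* (c₀ :* v)) refl (c j) (c₀ j) k (v j)) ⟩
    sum (λ j → c j * v j + (- k) * (c₀ j * v j))       ≡⟨ ∑-distrib-+ (λ j → c j * v j) _ ⟩
    dot c v + sum (λ j → (- k) * (c₀ j * v j))         ≡⟨ cong (dot c v +_) (sym (*-distribˡ-sum (- k) (λ j → c₀ j * v j))) ⟩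
    dot c v + (- k) * dot c₀ v                         ≡⟨ cong (dot c v +_) (sym (-‿distribˡ-* k (dot c₀ v))) ⟩
    dot c v − k * dot c₀ v                             ∎
    where open ≡-Reasoning

  eliminate : ∀ {N} (c c₀ : Fin (suc N) → ℝ) r r₀ k v → c zero ≡ k * c₀ zero →
              dot c v ≡ r → dot c₀ v ≡ r₀ →
              dot (λ j → c (suc j) − k * c₀ (suc j)) (v ∘ suc) ≡ r − k * r₀
  eliminate c c₀ r r₀ k v c≡k·c₀ c·v≡r c₀·v≡r₀ = begin
    dot (λ j → c (suc j) − k * c₀ (suc j)) (v ∘ suc)   ≡⟨ dot-linear (c ∘ suc) (c₀ ∘ suc) k (v ∘ suc) ⟩
    D − k * D₀                                          ≡⟨ solve 5 (λ D D₀ k c₀₀ v₀ → D :- k :* D₀ := (k :* c₀₀ :* v₀ :+ D) :- k :* (c₀₀ :* v₀ :+ D₀)) refl D D₀ k (c₀ zero) (v zero) ⟩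
    (k * c₀ zero * v zero + D) − k * (c₀ zero * v zero + D₀)  ≡⟨ cong₂ (λ x y → x − k * y) (trans (cong (λ z → z * v zero + D) (sym c≡k·c₀)) c·v≡r) c₀·v≡r₀ ⟩
    r − k * r₀                                          ∎
    where
    open ≡-Reasoning
    D D₀ : ℝ
    D = dot (c ∘ suc) (v ∘ suc)
    D₀ = dot (c₀ ∘ suc) (v ∘ suc)

  back-substitute : ∀ {N} (c c₀ : Fin (suc N) → ℝ) r r₀ k w₀ (w : Fin N → ℝ) → c zero ≡ k * c₀ zero →
                    dot (λ j → c (suc j) − k * c₀ (suc j)) w ≡ r − k * r₀ →
                    c₀ zero * w₀ + dot (c₀ ∘ suc) w ≡ r₀ →
                    dot c (w₀ ∷ w) ≡ r
  back-substitute c c₀ r r₀ k w₀ w c≡k·c₀ reduced pivot = begin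
    c zero * w₀ + D                             ≡⟨ cong (λ z → z * w₀ + D) c≡k·c₀ ⟩
    k * c₀ zero * w₀ + D                        ≡⟨ solve 5 (λ k c₀₀ w₀ D D₀ → k :* c₀₀ :* w₀ :+ D := k :* (c₀₀ :* w₀ :+ D₀) :+ (D :- k :* D₀)) refl k (c₀ zero) w₀ D D₀ ⟩
    k * (c₀ zero * w₀ + D₀) + (D − k * D₀)      ≡⟨ cong₂ (λ x y → k * x + y) pivot (trans (sym (dot-linear (c ∘ suc) (c₀ ∘ suc) k w)) reduced) ⟩
    k * r₀ + (r − k * r₀)                       ≡⟨ solve 2 (λ x r → x :+ (r :- x) := r) refl (k * r₀) r ⟩
    r                                           ∎
    where
    open ≡-Reasoning
    D D₀ : ℝ
    D = dot (c ∘ suc) w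
    D₀ = dot (c₀ ∘ suc) w

  dot-zero-head : ∀ {N} (c : Fin (suc N) → ℝ) v → c zero ≡ 0ℝ → dot c v ≡ dot (c ∘ suc) (v ∘ suc)
  dot-zero-head c v head≡0 = trans (cong (λ z → z * v zero + dot (c ∘ suc) (v ∘ suc)) head≡0)
                                 (trans (cong (_+ dot (c ∘ suc) (v ∘ suc)) (zeroˡ (v zero))) (+-identityˡ _))

  record Equation (N : ℕ) : Set where
    constructor _≐_
    field
      coefficient : Fin N → QS
      rhs : QS

  open Equation

  Holds₊ Holds₋ : ∀ {N} → Equation N → (Fin N → ℝ) → Set
  Holds₊ e v = dot (σ₊ ∘ coefficient e) v ≡ σ₊ (rhs e)
  Holds₋ e w = dot (σ₋ ∘ coefficient e) w ≡ σ₋ (rhs e)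

  ConjugatelySolvable : ℕ → Set
  ConjugatelySolvable N = ∀ {m} (E : Fin m → Equation N) v → (∀ i → Holds₊ (E i) v) →
                          ∃ λ w → ∀ i → Holds₋ (E i) w

  leading : ∀ {N} → Equation (suc N) → QS
  leading e = coefficient e zero

  -- Without unknowns every right-hand side vanishes, and so does its conjugate.
  no-unknowns : ConjugatelySolvable 0
  no-unknowns E v holds = (λ ()) , λ i → sym (σ₊≡0⇒σ₋≡0 (rhs (E i)) (sym (holds i)))

  drop-unknown : ∀ {N} → ConjugatelySolvable N → ∀ {m} (E : Fin m → Equation (suc N)) v →
                 (∀ i → Holds₊ (E i) v) → (∀ i → σ₊ (leading (E i)) ≡ 0ℝ) → ∃ λ w → ∀ i → Holds₋ (E i) w
  drop-unknown solve-N E v holds absent with solve-N (λ i → (coefficient (E i) ∘ suc) ≐ rhs (E i)) (v ∘ suc)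
                                                    (λ i → trans (sym (dot-zero-head (σ₊ ∘ coefficient (E i)) v (absent i))) (holds i))
  ... | w , holds′ = (0ℝ ∷ w) , λ i → trans (dot-zero-head (σ₋ ∘ coefficient (E i)) (0ℝ ∷ w) (σ₊≡0⇒σ₋≡0 (leading (E i)) (absent i))) (holds′ i)

  pivot-unknown : ∀ {N} → ConjugatelySolvable N → ∀ {m} (E : Fin m → Equation (suc N)) v →
                  (∀ i → Holds₊ (E i) v) → ∀ i₀ → σ₊ (leading (E i₀)) ≢ 0ℝ → ∃ λ w → ∀ i → Holds₋ (E i) w
  pivot-unknown {N} solve-N {m} E v holds i₀ pivot≢0 = (w₀ ∷ w) , λ i → back-substitute (σ₋ ∘ coefficient (E i)) (σ₋ ∘ coefficient (E i₀)) _ _ _ w₀ w (multiple₋ i) (reduced-holds₋ i) pivot-solved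
    where
    open Inverse (invert (leading (E i₀)) pivot≢0) renaming (element to pivot⁻¹)
    factor : Fin m → QS
    factor i = leading (E i) ⊗ pivot⁻¹
    -- E i − factor i · E i₀, without its (vanishing) first coefficient
    reduced : Fin m → Equation N
    reduced i = (λ j → coefficient (E i) (suc j) ⊕ ⊝ (factor i ⊗ coefficient (E i₀) (suc j)))
                  ≐ (rhs (E i) ⊕ ⊝ (factor i ⊗ rhs (E i₀)))
    multiple₊ : ∀ i → σ₊ (leading (E i)) ≡ σ₊ (factor i) * σ₊ (leading (E i₀))
    multiple₊ i = sym (trans (*-assoc _ _ _) (trans (cong (σ₊ (leading (E i)) *_) inverse₊) (*-identityʳ _)))
    multiple₋ : ∀ i → σ₋ (leading (E i)) ≡ σ₋ (factor i) * σ₋ (leading (E i₀))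
    multiple₋ i = sym (trans (*-assoc _ _ _) (trans (cong (σ₋ (leading (E i)) *_) inverse₋) (*-identityʳ _)))
    reduced-solution : ∃ λ w → ∀ i → Holds₋ (reduced i) w
    reduced-solution = solve-N reduced (v ∘ suc) (λ i → eliminate (σ₊ ∘ coefficient (E i)) (σ₊ ∘ coefficient (E i₀)) _ _ _ v (multiple₊ i) (holds i) (holds i₀))
    w : Fin N → ℝ
    w = proj₁ reduced-solution
    reduced-holds₋ : ∀ i → Holds₋ (reduced i) w
    reduced-holds₋ = proj₂ reduced-solution
    c₀₀ r₀ D₀ w₀ : ℝ
    c₀₀ = σ₋ (leading (E i₀))
    r₀ = σ₋ (rhs (E i₀))
    D₀ = dot (σ₋ ∘ coefficient (E i₀) ∘ suc) w
    w₀ = (r₀ − D₀) * σ₋ pivot⁻¹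
    pivot-solved : c₀₀ * w₀ + D₀ ≡ r₀
    pivot-solved = begin
      c₀₀ * ((r₀ − D₀) * σ₋ pivot⁻¹) + D₀   ≡⟨ solve 4 (λ c r D i → c :* ((r :- D) :* i) :+ D := (i :* c) :* (r :- D) :+ D) refl c₀₀ r₀ D₀ (σ₋ pivot⁻¹) ⟩
      (σ₋ pivot⁻¹ * c₀₀) * (r₀ − D₀) + D₀   ≡⟨ cong (λ z → z * (r₀ − D₀) + D₀) inverse₋ ⟩
      1ℝ * (r₀ − D₀) + D₀                   ≡⟨ solve 2 (λ r D → con ℤ.1ℤ :* (r :- D) :+ D := r) refl r₀ D₀ ⟩
      r₀                                    ∎
      where open ≡-Reasoning

  conjugate-solution : ∀ N → ConjugatelySolvable N
  conjugate-solution zero = no-unknowns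
  conjugate-solution (suc N) E v holds with any? (λ i → ¬? (σ₊ (leading (E i)) ≟ 0ℝ))
  ... | yes (i₀ , pivot≢0) = pivot-unknown (conjugate-solution N) E v holds i₀ pivot≢0
  ... | no no-pivot = drop-unknown (conjugate-solution N) E v holds
                        (λ i → decidable-stable (σ₊ (leading (E i)) ≟ 0ℝ) (λ σ₊≢0 → no-pivot (i , σ₊≢0)))

-- Finite grids on the real line, indicator functions, and the telescoping
-- identity  Σ_{grid cells (p,p′) ⊆ [u,v]} (φ p′ − φ p) = φ v − φ u.
module Telescoping (R : RealField) where

  open import Data.Empty using (⊥-elim)
  open import Data.Nat using (zero; suc)
  open import Data.Fin using (Fin; zero; suc)
  open import Data.Integer as ℤ using ()
  import Data.Fin.Properties as FinP
  open import Data.List using ([]; _∷_; foldr)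
  open import Data.List.Relation.Unary.All as All using (All; []; _∷_)
  open import Data.List.Relation.Unary.AllPairs using (AllPairs; []; _∷_)
  open import Data.List.Relation.Unary.Any using (here; there)
  open import Data.List.Membership.Propositional using (_∈_)
  open import Data.List.Membership.Propositional.Properties using (∈-lookup)
  open import Function using (_∘_)
  open import Relation.Nullary using (Dec; yes; no)
  open import Relation.Nullary.Decidable using (_×-dec_)
  open import Relation.Binary.Definitions using (tri<; tri≈; tri>)
  open OrderedField R

  sumL : ∀ {A : Set} → List A → (A → ℝ) → ℝ
  sumL L f = sum (f ∘ lookup L)

  sumL-cong : ∀ {A : Set} (L : List A) {f g : A → ℝ} → (∀ x → x ∈ L → f x ≡ g x) → sumL L f ≡ sumL L g
  sumL-cong L f≗g = sum-cong-≗ (λ k → f≗g _ (∈-lookup k))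

  sum-product : ∀ {m n} (f : Fin m → ℝ) (g : Fin n → ℝ) → sum f * sum g ≡ sum (λ k → sum (λ l → f k * g l))
  sum-product f g = trans (*-distribʳ-sum (sum g) f) (sum-cong-≗ (λ k → *-distribˡ-sum (f k) g))

  sum-nonpos : ∀ {n} (f : Fin n → ℝ) → (∀ i → f i ≤ 0ℝ) → sum f ≤ 0ℝ
  sum-nonpos {zero} f f≤0 = ≤-refl
  sum-nonpos {suc n} f f≤0 = nonpos-add (f≤0 zero) (sum-nonpos (f ∘ suc) (f≤0 ∘ suc))

  [_] : ∀ {A : Set} → Dec A → ℝ
  [ yes _ ] = 1ℝ
  [ no _ ] = 0ℝ

  [yes] : ∀ {A : Set} → A → (d : Dec A) → [ d ] ≡ 1ℝ
  [yes] a (yes _) = refl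
  [yes] a (no ¬a) = ⊥-elim (¬a a)

  [no] : ∀ {A : Set} → ¬ A → (d : Dec A) → [ d ] ≡ 0ℝ
  [no] ¬a (yes a) = ⊥-elim (¬a a)
  [no] ¬a (no _) = refl

  [×] : ∀ {A B : Set} (da : Dec A) (db : Dec B) → [ da ×-dec db ] ≡ [ da ] * [ db ]
  [×] (yes a) (yes b) = sym (*-identityˡ 1ℝ)
  [×] (yes a) (no b) = sym (zeroʳ 1ℝ)
  [×] (no a) (yes b) = sym (zeroˡ 1ℝ)
  [×] (no a) (no b) = sym (zeroˡ 0ℝ)

  count-none : ∀ {n} (D : Fin n → Set) (d : ∀ i → Dec (D i)) → (∀ i → ¬ D i) → sum (λ i → [ d i ]) ≡ 0ℝ
  count-none {zero} D d none = refl
  count-none {suc n} D d none = trans (cong₂ _+_ ([no] (none zero) (d zero)) (count-none (D ∘ suc) (d ∘ suc) (none ∘ suc))) (+-identityˡ 0ℝ)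

  count-unique : ∀ {n} (D : Fin n → Set) (d : ∀ i → Dec (D i)) → (∀ i j → D i → D j → i ≡ j) → Σ (Fin n) D →
                 sum (λ i → [ d i ]) ≡ 1ℝ
  count-unique {suc n} D d unique (zero , D₀) =
    trans (cong₂ _+_ ([yes] D₀ (d zero)) (count-none (D ∘ suc) (d ∘ suc) (λ i Dᵢ → 0≢suc (unique _ _ D₀ Dᵢ)))) (+-identityʳ 1ℝ)
    where
    0≢suc : ∀ {i : Fin n} → Fin.zero ≢ suc i
    0≢suc ()
  count-unique {suc n} D d unique (suc i , Dᵢ) =
    trans (cong₂ _+_ ([no] (λ D₀ → 0≢suc (unique _ _ D₀ Dᵢ)) (d zero))
                     (count-unique (D ∘ suc) (d ∘ suc) (λ i j Dᵢ Dⱼ → FinP.suc-injective (unique _ _ Dᵢ Dⱼ)) (i , Dᵢ)))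
          (+-identityˡ 1ℝ)
    where
    0≢suc : Fin.zero ≢ suc i
    0≢suc ()

  Sorted : List ℝ → Set
  Sorted = AllPairs _<_

  insert : ℝ → List ℝ → List ℝ
  insert x [] = x ∷ []
  insert x (y ∷ l) with compare x y
  ... | tri< _ _ _ = x ∷ y ∷ l
  ... | tri≈ _ _ _ = y ∷ l
  ... | tri> _ _ _ = y ∷ insert x l

  insert-bounded : ∀ {z} x l → All (z <_) l → z < x → All (z <_) (insert x l)
  insert-bounded x [] _ z<x = z<x ∷ []
  insert-bounded x (y ∷ l) z<l z<x with compare x y
  ... | tri< _ _ _ = z<x ∷ z<l
  ... | tri≈ _ _ _ = z<l
  insert-bounded x (y ∷ l) (z<y ∷ z<l) z<x | tri> _ _ _ = z<y ∷ insert-bounded x l z<l z<x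

  insert-sorted : ∀ x l → Sorted l → Sorted (insert x l)
  insert-sorted x [] _ = [] ∷ []
  insert-sorted x (y ∷ l) (y<l ∷ sl) with compare x y
  ... | tri< x<y _ _ = (x<y ∷ All.map (λ {z} y<z → <-trans x y z x<y y<z) y<l) ∷ y<l ∷ sl
  ... | tri≈ _ _ _ = y<l ∷ sl
  ... | tri> _ _ y<x = insert-bounded x l y<l y<x ∷ insert-sorted x l sl

  insert-∈ : ∀ x l → x ∈ insert x l
  insert-∈ x [] = here refl
  insert-∈ x (y ∷ l) with compare x y
  ... | tri< _ _ _ = here refl
  ... | tri≈ _ x≡y _ = here x≡y
  ... | tri> _ _ _ = there (insert-∈ x l)

  insert-⊇ : ∀ {z} x l → z ∈ l → z ∈ insert x l
  insert-⊇ x (y ∷ l) z∈ with compare x y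
  ... | tri< _ _ _ = there z∈
  ... | tri≈ _ _ _ = z∈
  insert-⊇ x (y ∷ l) (here z≡y) | tri> _ _ _ = here z≡y
  insert-⊇ x (y ∷ l) (there z∈l) | tri> _ _ _ = there (insert-⊇ x l z∈l)

  grid : List ℝ → List ℝ
  grid = foldr insert []

  grid-sorted : ∀ L → Sorted (grid L)
  grid-sorted [] = []
  grid-sorted (x ∷ L) = insert-sorted x (grid L) (grid-sorted L)

  grid-∈ : ∀ {z} L → z ∈ L → z ∈ grid L
  grid-∈ (x ∷ L) (here refl) = insert-∈ x (grid L)
  grid-∈ (x ∷ L) (there z∈L) = insert-⊇ x (grid L) (grid-∈ L z∈L)

  cells : List ℝ → List (ℝ × ℝ)
  cells [] = []
  cells (x ∷ []) = []
  cells (x ∷ y ∷ l) = (x , y) ∷ cells (y ∷ l)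

  head-least : ∀ {y z} l → Sorted (y ∷ l) → z ∈ (y ∷ l) → y ≤ z
  head-least l _ (here refl) = ≤-refl
  head-least l (y<l ∷ _) (there z∈l) = inj₁ (All.lookup y<l z∈l)

  cell-∈ : ∀ P {c} → c ∈ cells P → proj₁ c ∈ P × proj₂ c ∈ P
  cell-∈ (x ∷ y ∷ l) (here refl) = here refl , there (here refl)
  cell-∈ (x ∷ y ∷ l) (there c∈) = let (p∈ , p′∈) = cell-∈ (y ∷ l) c∈ in there p∈ , there p′∈

  cell-< : ∀ P {c} → Sorted P → c ∈ cells P → proj₁ c < proj₂ c
  cell-< (x ∷ y ∷ l) ((x<y ∷ _) ∷ _) (here refl) = x<y
  cell-< (x ∷ y ∷ l) (_ ∷ sorted) (there c∈) = cell-< (y ∷ l) sorted c∈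

  cell-empty : ∀ P {c z} → Sorted P → c ∈ cells P → z ∈ P → z ≤ proj₁ c ⊎ proj₂ c ≤ z
  cell-empty (x ∷ y ∷ l) sorted (here refl) (here refl) = inj₁ ≤-refl
  cell-empty (x ∷ y ∷ l) (_ ∷ sorted) (here refl) (there z∈) = inj₂ (head-least l sorted z∈)
  cell-empty (x ∷ y ∷ l) (x<l ∷ sorted) (there c∈) (here refl) = inj₁ (inj₁ (All.lookup x<l (proj₁ (cell-∈ (y ∷ l) c∈))))
  cell-empty (x ∷ y ∷ l) (_ ∷ sorted) (there c∈) (there z∈) = cell-empty (y ∷ l) sorted c∈ z∈

  below-cell : ∀ P {p p′ w z} → Sorted P → (p , p′) ∈ cells P → w < p′ → z ∈ P → z ≤ w → z ≤ p
  below-cell P sorted c∈ w<p′ z∈ z≤w with cell-empty P sorted c∈ z∈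
  ... | inj₁ z≤p = z≤p
  ... | inj₂ p′≤z = ⊥-elim (<⇒¬≥ w<p′ (≤-trans p′≤z z≤w))

  above-cell : ∀ P {p p′ w z} → Sorted P → (p , p′) ∈ cells P → p < w → z ∈ P → w ≤ z → p′ ≤ z
  above-cell P sorted c∈ p<w z∈ w≤z with cell-empty P sorted c∈ z∈
  ... | inj₁ z≤p = ⊥-elim (<⇒¬≥ p<w (≤-trans w≤z z≤p))
  ... | inj₂ p′≤z = p′≤z

  increment : (ℝ → ℝ) → ℝ → ℝ → ℝ × ℝ → ℝ
  increment φ u v (p , p′) = ([ u ≤? p ] * [ p′ ≤? v ]) * (φ p′ − φ p)

  increments : (ℝ → ℝ) → List ℝ → ℝ → ℝ → ℝ
  increments φ P u v = sumL (cells P) (increment φ u v)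

  increments-beyond : ∀ φ u v y L → Sorted (y ∷ L) → v < y → increments φ (y ∷ L) u v ≡ 0ℝ
  increments-beyond φ u v y [] _ _ = refl
  increments-beyond φ u v y (z ∷ L) ((y<z ∷ _) ∷ sorted) v<y = begin
      ([ u ≤? y ] * [ z ≤? v ]) * (φ z − φ y) + increments φ (z ∷ L) u v
        ≡⟨ cong₂ (λ a b → ([ u ≤? y ] * a) * (φ z − φ y) + b) ([no] (<⇒¬≥ v<z) (z ≤? v)) (increments-beyond φ u v z L sorted v<z) ⟩
      ([ u ≤? y ] * 0ℝ) * (φ z − φ y) + 0ℝ
        ≡⟨ solve 2 (λ a b → a :* con ℤ.0ℤ :* b :+ con ℤ.0ℤ := con ℤ.0ℤ) refl [ u ≤? y ] (φ z − φ y) ⟩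
      0ℝ ∎
    where
    open ≡-Reasoning
    v<z : v < z
    v<z = <-trans v y z v<y y<z

  increments-below : ∀ φ u u′ v y L → Sorted (y ∷ L) → u ≤ y → u′ ≤ y → increments φ (y ∷ L) u v ≡ increments φ (y ∷ L) u′ v
  increments-below φ u u′ v y [] _ _ _ = refl
  increments-below φ u u′ v y (z ∷ L) ((y<z ∷ _) ∷ sorted) u≤y u′≤y =
    cong₂ (λ a b → (a * [ z ≤? v ]) * (φ z − φ y) + b)
      (trans ([yes] u≤y (u ≤? y)) (sym ([yes] u′≤y (u′ ≤? y))))
      (increments-below φ u u′ v z L sorted (inj₁ (≤-<-trans u≤y y<z)) (inj₁ (≤-<-trans u′≤y y<z)))

  telescope : ∀ φ P {u v} → Sorted P → u ∈ P → v ∈ P → u ≤ v → increments φ P u v ≡ φ v − φ u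
  telescope φ (x ∷ []) _ (here refl) (here refl) _ = sym (+-inverseʳ _)
  telescope φ (x ∷ y ∷ l) ((x<y ∷ _) ∷ sorted) (here refl) (here refl) _ = begin
      ([ x ≤? x ] * [ y ≤? x ]) * (φ y − φ x) + increments φ (y ∷ l) x x
        ≡⟨ cong₂ (λ a b → ([ x ≤? x ] * a) * (φ y − φ x) + b) ([no] (<⇒¬≥ x<y) (y ≤? x)) (increments-beyond φ x x y l sorted x<y) ⟩
      ([ x ≤? x ] * 0ℝ) * (φ y − φ x) + 0ℝ
        ≡⟨ solve 3 (λ a b c → a :* con ℤ.0ℤ :* b :+ con ℤ.0ℤ := c :- c) refl [ x ≤? x ] (φ y − φ x) (φ x) ⟩
      φ x − φ x ∎
    where open ≡-Reasoning
  telescope φ (x ∷ y ∷ l) {v = v} ((x<y ∷ _) ∷ sorted) (here refl) (there v∈) _ = begin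
      ([ x ≤? x ] * [ y ≤? v ]) * (φ y − φ x) + increments φ (y ∷ l) x v
        ≡⟨ cong₂ (λ a b → (a * b) * (φ y − φ x) + increments φ (y ∷ l) x v) ([yes] ≤-refl (x ≤? x)) ([yes] (head-least l sorted v∈) (y ≤? v)) ⟩
      (1ℝ * 1ℝ) * (φ y − φ x) + increments φ (y ∷ l) x v
        ≡⟨ cong₂ (λ a b → a * (φ y − φ x) + b) (*-identityˡ 1ℝ) (increments-below φ x y v y l sorted (inj₁ x<y) ≤-refl) ⟩
      1ℝ * (φ y − φ x) + increments φ (y ∷ l) y v
        ≡⟨ cong₂ _+_ (*-identityˡ _) (telescope φ (y ∷ l) sorted (here refl) v∈ (head-least l sorted v∈)) ⟩
      (φ y − φ x) + (φ v − φ y)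
        ≡⟨ solve 3 (λ a b c → (b :- a) :+ (c :- b) := c :- a) refl (φ x) (φ y) (φ v) ⟩
      φ v − φ x ∎
    where open ≡-Reasoning
  telescope φ (x ∷ y ∷ l) {u} {v} ((x<y ∷ _) ∷ sorted) (there u∈) v∈ u≤v = begin
      ([ u ≤? x ] * [ y ≤? v ]) * (φ y − φ x) + increments φ (y ∷ l) u v
        ≡⟨ cong₂ (λ a b → (a * [ y ≤? v ]) * (φ y − φ x) + b) ([no] (<⇒¬≥ x<u) (u ≤? x)) (telescope φ (y ∷ l) sorted u∈ (v∈tail v∈) u≤v) ⟩
      (0ℝ * [ y ≤? v ]) * (φ y − φ x) + (φ v − φ u)
        ≡⟨ solve 4 (λ a b c d → con ℤ.0ℤ :* a :* b :+ (c :- d) := c :- d) refl [ y ≤? v ] (φ y − φ x) (φ v) (φ u) ⟩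
      φ v − φ u ∎
    where
    open ≡-Reasoning
    x<u : x < u
    x<u = <-≤-trans x<y (head-least l sorted u∈)
    v∈tail : v ∈ (x ∷ y ∷ l) → v ∈ (y ∷ l)
    v∈tail (here refl) = ⊥-elim (<⇒¬≥ x<u u≤v)
    v∈tail (there v∈) = v∈

-- Additivity: for a tiling of a square [a,a+d]×[b,b+d] by rectangles
-- [x₀,x₁]×[y₀,y₁] and arbitrary functions φ, ψ : ℝ → ℝ,
--   Σ_tiles (φ x₁ − φ x₀)(ψ y₁ − ψ y₀) = (φ(a+d) − φ a)(ψ(b+d) − ψ b).
-- Both sides expand, by telescoping, into sums over the cells of the grid of
-- all coordinates; each grid cell inside the square lies in exactly one tile.

module Additivity (R : RealField) where

  open import Data.Nat using (zero; suc)
  open import Data.Fin using (Fin; zero; suc)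
  import Data.Fin.Properties as FinP
  open import Data.Integer as ℤ using ()
  open import Data.Empty using (⊥-elim)
  open import Data.List using ([]; _∷_)
  open import Data.List.Relation.Unary.Any using (here; there)
  open import Data.List.Membership.Propositional using (_∈_)
  open import Function using (_∘_)
  open import Relation.Nullary using (Dec; yes; no)
  open import Relation.Nullary.Decidable using (_×-dec_)
  open import Relation.Binary.Definitions using (tri<; tri≈; tri>)
  open OrderedField R
  open Telescoping R
  open Rect

  coordinates : List (Rect R) → List ℝ
  coordinates [] = []
  coordinates (r ∷ rs) = x₀ r ∷ x₁ r ∷ y₀ r ∷ y₁ r ∷ coordinates rs

  record OnGrid (P : List ℝ) (r : Rect R) : Set where
    field
      x₀∈ : x₀ r ∈ P
      x₁∈ : x₁ r ∈ P
      y₀∈ : y₀ r ∈ P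
      y₁∈ : y₁ r ∈ P

  on-coordinates : ∀ rs i → OnGrid (coordinates rs) (lookup rs i)
  on-coordinates (r ∷ rs) zero = record
    { x₀∈ = here refl ; x₁∈ = there (here refl) ; y₀∈ = there (there (here refl)) ; y₁∈ = there (there (there (here refl))) }
  on-coordinates (r ∷ rs) (suc i) = record { x₀∈ = skip x₀∈ ; x₁∈ = skip x₁∈ ; y₀∈ = skip y₀∈ ; y₁∈ = skip y₁∈ }
    where
    open OnGrid (on-coordinates rs i)
    skip : ∀ {z} → z ∈ coordinates rs → z ∈ coordinates (r ∷ rs)
    skip z∈ = there (there (there (there z∈)))

  tiling-points : List (Rect R) → ℝ → ℝ → ℝ → List ℝ
  tiling-points rs a b d = a ∷ (a + d) ∷ b ∷ (b + d) ∷ coordinates rs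

  tiling-grid : List (Rect R) → ℝ → ℝ → ℝ → List ℝ
  tiling-grid rs a b d = grid (tiling-points rs a b d)

  square-on-grid : ∀ rs a b d → OnGrid (tiling-grid rs a b d) (square R a b d)
  square-on-grid rs a b d = record
    { x₀∈ = grid-∈ points (here refl) ; x₁∈ = grid-∈ points (there (here refl))
    ; y₀∈ = grid-∈ points (there (there (here refl))) ; y₁∈ = grid-∈ points (there (there (there (here refl)))) }
    where
    points : List ℝ
    points = tiling-points rs a b d

  tile-on-grid : ∀ rs a b d i → OnGrid (tiling-grid rs a b d) (lookup rs i)
  tile-on-grid rs a b d i = record { x₀∈ = on-grid x₀∈ ; x₁∈ = on-grid x₁∈ ; y₀∈ = on-grid y₀∈ ; y₁∈ = on-grid y₁∈ }
    where
    open OnGrid (on-coordinates rs i)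
    on-grid : ∀ {z} → z ∈ coordinates rs → z ∈ tiling-grid rs a b d
    on-grid z∈ = grid-∈ (tiling-points rs a b d) (there (there (there (there z∈))))

  between : ∀ {p p′} → p < p′ → ∃ λ m → p < m × m < p′
  between {p} {p′} p<p′ with *-inverse two (λ 2≡0 → <⇒≢ (<-trans 0ℝ 1ℝ two 0<1 1<2) (sym 2≡0))
  ... | h , h·2≡1 = p + (p′ − p) * h , pos-sub (subst (0ℝ <_) left gap) , pos-sub (subst (0ℝ <_) right gap)
    where
    0<h : 0ℝ < h
    0<h with compare 0ℝ h
    ... | tri< 0<h _ _ = 0<h
    ... | tri≈ _ refl _ = ⊥-elim (0≢1 (trans (sym (zeroˡ two)) h·2≡1))
    ... | tri> _ _ h<0 = ⊥-elim (<-asym 0<1 (subst (_< 0ℝ) (trans (*-comm two h) h·2≡1)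
                                  (subst (_< 0ℝ) (solve 2 (λ t h → :- (t :* (:- h)) := t :* h) refl two h)
                                    (pos-neg (*-pos _ _ (<-trans 0ℝ 1ℝ two 0<1 1<2) (neg-pos h<0))))))
    gap : 0ℝ < (p′ − p) * h
    gap = *-pos _ _ (sub-pos p<p′) 0<h
    left : (p′ − p) * h ≡ (p + (p′ − p) * h) − p
    left = solve 3 (λ p p′ h → (p′ :- p) :* h := (p :+ (p′ :- p) :* h) :- p) refl p p′ h
    right : (p′ − p) * h ≡ p′ − (p + (p′ − p) * h)
    right = begin
      (p′ − p) * h                                   ≡⟨ solve 3 (λ p p′ h → (p′ :- p) :* h := (p′ :- p) :* (h :* (con ℤ.1ℤ :+ con ℤ.1ℤ)) :- (p′ :- p) :* h) refl p p′ h ⟩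
      (p′ − p) * (h * two) − (p′ − p) * h            ≡⟨ cong (λ z → (p′ − p) * z − (p′ − p) * h) h·2≡1 ⟩
      (p′ − p) * 1ℝ − (p′ − p) * h                   ≡⟨ solve 3 (λ p p′ h → (p′ :- p) :* con ℤ.1ℤ :- (p′ :- p) :* h := p′ :- (p :+ (p′ :- p) :* h)) refl p p′ h ⟩
      p′ − (p + (p′ − p) * h)                        ∎
      where open ≡-Reasoning

  area : (ℝ → ℝ) → (ℝ → ℝ) → Rect R → ℝ
  area φ ψ r = (φ (x₁ r) − φ (x₀ r)) * (ψ (y₁ r) − ψ (y₀ r))

  cell-area : (ℝ → ℝ) → (ℝ → ℝ) → ℝ × ℝ → ℝ × ℝ → ℝ
  cell-area φ ψ (p , p′) (q , q′) = (φ p′ − φ p) * (ψ q′ − ψ q)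

  Contains : Rect R → ℝ × ℝ → ℝ × ℝ → Set
  Contains r (p , p′) (q , q′) = (x₀ r ≤ p × p′ ≤ x₁ r) × (y₀ r ≤ q × q′ ≤ y₁ r)

  contains? : ∀ r c c′ → Dec (Contains r c c′)
  contains? r (p , p′) (q , q′) = ((x₀ r ≤? p) ×-dec (p′ ≤? x₁ r)) ×-dec ((y₀ r ≤? q) ×-dec (q′ ≤? y₁ r))

  increment-product : ∀ φ ψ r c c′ →
    increment φ (x₀ r) (x₁ r) c * increment ψ (y₀ r) (y₁ r) c′ ≡ [ contains? r c c′ ] * cell-area φ ψ c c′
  increment-product φ ψ r (p , p′) (q , q′) = begin
      ((i₁ * i₂) * δ) * ((i₃ * i₄) * ε)   ≡⟨ solve 6 (λ i₁ i₂ i₃ i₄ δ ε → ((i₁ :* i₂) :* δ) :* ((i₃ :* i₄) :* ε) := ((i₁ :* i₂) :* (i₃ :* i₄)) :* (δ :* ε)) refl i₁ i₂ i₃ i₄ δ ε ⟩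
      ((i₁ * i₂) * (i₃ * i₄)) * (δ * ε)   ≡⟨ cong (_* (δ * ε)) (sym (trans ([×] (x₀ r ≤? p ×-dec p′ ≤? x₁ r) (y₀ r ≤? q ×-dec q′ ≤? y₁ r))
                                                   (cong₂ _*_ ([×] (x₀ r ≤? p) (p′ ≤? x₁ r)) ([×] (y₀ r ≤? q) (q′ ≤? y₁ r))))) ⟩
      [ contains? r (p , p′) (q , q′) ] * (δ * ε) ∎
    where
    open ≡-Reasoning
    i₁ i₂ i₃ i₄ δ ε : ℝ
    i₁ = [ x₀ r ≤? p ]
    i₂ = [ p′ ≤? x₁ r ]
    i₃ = [ y₀ r ≤? q ]
    i₄ = [ q′ ≤? y₁ r ]
    δ = φ p′ − φ p
    ε = ψ q′ − ψ q

  area-expansion : ∀ φ ψ P r → Sorted P → OnGrid P r → x₀ r ≤ x₁ r → y₀ r ≤ y₁ r →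
    area φ ψ r ≡ sumL (cells P) (λ c → sumL (cells P) (λ c′ → [ contains? r c c′ ] * cell-area φ ψ c c′))
  area-expansion φ ψ P r sorted on-grid x₀≤x₁ y₀≤y₁ = begin
      area φ ψ r
        ≡⟨ sym (cong₂ _*_ (telescope φ P sorted x₀∈ x₁∈ x₀≤x₁) (telescope ψ P sorted y₀∈ y₁∈ y₀≤y₁)) ⟩
      increments φ P (x₀ r) (x₁ r) * increments ψ P (y₀ r) (y₁ r)
        ≡⟨ sum-product (increment φ (x₀ r) (x₁ r) ∘ lookup (cells P)) (increment ψ (y₀ r) (y₁ r) ∘ lookup (cells P)) ⟩
      sumL (cells P) (λ c → sumL (cells P) (λ c′ → increment φ (x₀ r) (x₁ r) c * increment ψ (y₀ r) (y₁ r) c′))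
        ≡⟨ sum-cong-≗ (λ k → sum-cong-≗ (λ l → increment-product φ ψ r (lookup (cells P) k) (lookup (cells P) l))) ⟩
      sumL (cells P) (λ c → sumL (cells P) (λ c′ → [ contains? r c c′ ] * cell-area φ ψ c c′)) ∎
    where
    open ≡-Reasoning
    open OnGrid on-grid

  -- In a tiling, every grid cell of the square lies in exactly one tile.
  module CellCover {rs : List (Rect R)} {a b d : ℝ} (tiling : Tiles R rs a b d) where

    P : List ℝ
    P = tiling-grid rs a b d

    sorted : Sorted P
    sorted = grid-sorted (tiling-points rs a b d)

    proper : ∀ i → Proper R (lookup rs i)
    proper = proj₁ tiling
    inside : ∀ i p q → InClosed R (lookup rs i) p q → InClosed R (square R a b d) p q
    inside = proj₁ (proj₂ tiling)
    covered : ∀ p q → InClosed R (square R a b d) p q → ∃ λ i → InClosed R (lookup rs i) p q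
    covered = proj₁ (proj₂ (proj₂ tiling))
    disjoint : ∀ i j → i ≢ j → ∀ p q → ¬ (InInterior R (lookup rs i) p q × InInterior R (lookup rs j) p q)
    disjoint = proj₂ (proj₂ (proj₂ tiling))

    module _ {p p′ q q′ : ℝ} (c∈ : (p , p′) ∈ cells P) (c′∈ : (q , q′) ∈ cells P) where

      -- a point (m, k) in the interior of the product cell
      m k : ℝ
      m = proj₁ (between (cell-< P sorted c∈))
      k = proj₁ (between (cell-< P sorted c′∈))

      p<m : p < m
      p<m = proj₁ (proj₂ (between (cell-< P sorted c∈)))
      m<p′ : m < p′
      m<p′ = proj₂ (proj₂ (between (cell-< P sorted c∈)))
      q<k : q < k
      q<k = proj₁ (proj₂ (between (cell-< P sorted c′∈)))
      k<q′ : k < q′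
      k<q′ = proj₂ (proj₂ (between (cell-< P sorted c′∈)))

      interior : ∀ {r} → Contains r (p , p′) (q , q′) → InInterior R r m k
      interior ((x₀≤p , p′≤x₁) , (y₀≤q , q′≤y₁)) =
        (≤-<-trans x₀≤p p<m , <-≤-trans m<p′ p′≤x₁) , (≤-<-trans y₀≤q q<k , <-≤-trans k<q′ q′≤y₁)

      at-most-one : ∀ i j → Contains (lookup rs i) (p , p′) (q , q′) → Contains (lookup rs j) (p , p′) (q , q′) → i ≡ j
      at-most-one i j cᵢ cⱼ with i FinP.≟ j
      ... | yes i≡j = i≡j
      ... | no i≢j = ⊥-elim (disjoint i j i≢j m k (interior cᵢ , interior cⱼ))

      -- The tile containing the interior point of a cell of the square contains the cell.
      some-tile : Contains (square R a b d) (p , p′) (q , q′) → Σ (Fin (length rs)) λ i → Contains (lookup rs i) (p , p′) (q , q′)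
      some-tile in-sq = containing-tile (covered m k (closed (interior in-sq)))
        where
        closed : ∀ {r} → InInterior R r m k → InClosed R r m k
        closed ((x₀<m , m<x₁) , (y₀<k , k<y₁)) = (inj₁ x₀<m , inj₁ m<x₁) , (inj₁ y₀<k , inj₁ k<y₁)
        containing-tile : (∃ λ i → InClosed R (lookup rs i) m k) → Σ (Fin (length rs)) λ i → Contains (lookup rs i) (p , p′) (q , q′)
        containing-tile (i , ((x₀≤m , m≤x₁) , (y₀≤k , k≤y₁))) =
          i , (below-cell P sorted c∈ m<p′ x₀∈ x₀≤m , above-cell P sorted c∈ p<m x₁∈ m≤x₁) ,
              (below-cell P sorted c′∈ k<q′ y₀∈ y₀≤k , above-cell P sorted c′∈ q<k y₁∈ k≤y₁)
          where open OnGrid (tile-on-grid rs a b d i)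

      in-square : ∀ i → Contains (lookup rs i) (p , p′) (q , q′) → Contains (square R a b d) (p , p′) (q , q′)
      in-square i ((x₀≤p , p′≤x₁) , (y₀≤q , q′≤y₁)) =
        (≤-trans (proj₁ (proj₁ lower)) x₀≤p , ≤-trans p′≤x₁ (proj₂ (proj₁ upper))) ,
        (≤-trans (proj₁ (proj₂ lower)) y₀≤q , ≤-trans q′≤y₁ (proj₂ (proj₂ upper)))
        where
        tile : Rect R
        tile = lookup rs i
        x₀≤x₁ : x₀ tile ≤ x₁ tile
        x₀≤x₁ = inj₁ (proj₁ (proper i))
        y₀≤y₁ : y₀ tile ≤ y₁ tile
        y₀≤y₁ = inj₁ (proj₂ (proper i))
        lower : InClosed R (square R a b d) (x₀ tile) (y₀ tile)
        lower = inside i _ _ ((≤-refl , x₀≤x₁) , (≤-refl , y₀≤y₁))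
        upper : InClosed R (square R a b d) (x₁ tile) (y₁ tile)
        upper = inside i _ _ ((x₀≤x₁ , ≤-refl) , (y₀≤y₁ , ≤-refl))

      contains : Fin (length rs) → Set
      contains i = Contains (lookup rs i) (p , p′) (q , q′)

      contains?ᵢ : ∀ i → Dec (contains i)
      contains?ᵢ i = contains? (lookup rs i) (p , p′) (q , q′)

      covered-once : sum (λ i → [ contains?ᵢ i ]) ≡ [ contains? (square R a b d) (p , p′) (q , q′) ]
      covered-once with contains? (square R a b d) (p , p′) (q , q′)
      ... | yes in-sq = count-unique contains contains?ᵢ at-most-one (some-tile in-sq)
      ... | no ¬in-sq = count-none contains contains?ᵢ (λ i cᵢ → ¬in-sq (in-square i cᵢ))

  ≤-+-pos : ∀ x {d} → 0ℝ < d → x ≤ x + d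
  ≤-+-pos x 0<d = inj₁ (subst (_< x + _) (+-identityʳ x) (+-monoʳ-< x 0<d))

  tiling-additive : ∀ {rs a b d} → 0ℝ < d → Tiles R rs a b d → ∀ φ ψ →
                    sum (λ i → area φ ψ (lookup rs i)) ≡ area φ ψ (square R a b d)
  tiling-additive {rs} {a} {b} {d} 0<d tiling φ ψ = begin
      sum (λ i → area φ ψ (lookup rs i))
        ≡⟨ sum-cong-≗ (λ i → area-expansion φ ψ P (lookup rs i) sorted (tile-on-grid rs a b d i)
                                              (inj₁ (proj₁ (proper i))) (inj₁ (proj₂ (proper i)))) ⟩
      sum (λ i → sumL C (λ c → sumL C (λ c′ → [ contains? (lookup rs i) c c′ ] * cell-area φ ψ c c′)))
        ≡⟨ ∑-comm (λ i k → sumL C (term i (cell k))) ⟩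
      sumL C (λ c → sum (λ i → sumL C (λ c′ → [ contains? (lookup rs i) c c′ ] * cell-area φ ψ c c′)))
        ≡⟨ sum-cong-≗ (λ k → ∑-comm (λ i l → term i (cell k) (cell l))) ⟩
      sumL C (λ c → sumL C (λ c′ → sum (λ i → [ contains? (lookup rs i) c c′ ] * cell-area φ ψ c c′)))
        ≡⟨ sum-cong-≗ (λ k → sum-cong-≗ (λ l → sym (*-distribʳ-sum (cell-area φ ψ (cell k) (cell l)) (λ i → [ contains? (lookup rs i) (cell k) (cell l) ])))) ⟩
      sumL C (λ c → sumL C (λ c′ → sum (λ i → [ contains? (lookup rs i) c c′ ]) * cell-area φ ψ c c′))
        ≡⟨ sumL-cong C (λ c c∈ → sumL-cong C (λ c′ c′∈ → cong (_* cell-area φ ψ c c′) (covered-once c∈ c′∈))) ⟩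
      sumL C (λ c → sumL C (λ c′ → [ contains? (square R a b d) c c′ ] * cell-area φ ψ c c′))
        ≡⟨ sym (area-expansion φ ψ P (square R a b d) sorted (square-on-grid rs a b d) (≤-+-pos a 0<d) (≤-+-pos b 0<d)) ⟩
      area φ ψ (square R a b d) ∎
    where
    open ≡-Reasoning
    open CellCover {rs} {a} {b} {d} tiling
    C : List (ℝ × ℝ)
    C = cells P
    cell : Fin (length C) → ℝ × ℝ
    cell = lookup C
    term : Fin (length rs) → ℝ × ℝ → ℝ × ℝ → ℝ
    term i c c′ = [ contains? (lookup rs i) c c′ ] * cell-area φ ψ c c′

-- The linear system of a tiling by rectangles of aspect ratio 1 + s.

module TilingSystem (R : RealField) (s : RealField.ℝ R) (s²≡2 : RealField._*_ R s s ≡ OrderedField.two R) where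

  open import Data.Nat using (ℕ; zero; suc)
  open import Data.Fin using (Fin; zero; suc)
  open import Data.Integer as ℤ using ()
  open import Data.Maybe as Maybe using (Maybe; just; nothing; maybe)
  open import Data.Empty using (⊥-elim)
  open import Data.List using ([]; _∷_)
  open import Data.List.Relation.Unary.Any using (here; there)
  open import Data.List.Membership.Propositional using (_∈_)
  open import Function using (_∘_)
  open import Relation.Nullary using (yes; no)
  open import Relation.Binary.Definitions using (tri<; tri≈; tri>)
  open OrderedField R
  open QuadraticField R s s²≡2
  open ConjugateSystems R s s²≡2
  open Telescoping R using (sum-nonpos)
  open Additivity R using (tiling-grid; OnGrid; square-on-grid; tile-on-grid; area)
  open Rect

  -- Unit vectors; their coordinates are rational, so equal to their conjugates.
  unit : ∀ {N} → Fin N → Fin N → QS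
  unit zero zero = 𝟙
  unit zero (suc k) = 𝟘
  unit (suc i) zero = 𝟘
  unit (suc i) (suc k) = unit i k

  unit-rational : ∀ {N} (i k : Fin N) → σ₋ (unit i k) ≡ σ₊ (unit i k)
  unit-rational zero zero = refl
  unit-rational zero (suc k) = refl
  unit-rational (suc i) zero = refl
  unit-rational (suc i) (suc k) = unit-rational i k

  dot-zero : ∀ {N} (u : Fin N → ℝ) → dot (λ _ → 0ℝ) u ≡ 0ℝ
  dot-zero {zero} u = refl
  dot-zero {suc N} u = trans (cong₂ _+_ (zeroˡ (u zero)) (dot-zero (u ∘ suc))) (+-identityˡ 0ℝ)

  dot-unit : ∀ {N} (i : Fin N) u → dot (σ₊ ∘ unit i) u ≡ u i
  dot-unit {suc N} zero u = trans (cong₂ _+_ (*-identityˡ (u zero)) (dot-zero (u ∘ suc))) (+-identityʳ _)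
  dot-unit {suc N} (suc i) u = trans (cong₂ _+_ (zeroˡ (u zero)) (dot-unit i (u ∘ suc))) (+-identityˡ _)

  dot-unit₋ : ∀ {N} (i : Fin N) u → dot (σ₋ ∘ unit i) u ≡ u i
  dot-unit₋ i u = trans (sum-cong-≗ (λ k → cong (_* u k) (unit-rational i k))) (dot-unit i u)

  dot-+ : ∀ {N} (c c′ u : Fin N → ℝ) → dot (λ k → c k + c′ k) u ≡ dot c u + dot c′ u
  dot-+ c c′ u = trans (sum-cong-≗ (λ k → distribʳ (u k) (c k) (c′ k))) (∑-distrib-+ (λ k → c k * u k) (λ k → c′ k * u k))

  dot-scale : ∀ {N} α (c u : Fin N → ℝ) → dot (λ k → α * c k) u ≡ α * dot c u
  dot-scale α c u = trans (sum-cong-≗ (λ k → *-assoc α (c k) (u k))) (sym (*-distribˡ-sum α (λ k → c k * u k)))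

  dot-difference : ∀ {N} (c c′ u : Fin N → ℝ) → dot (λ k → c k + - c′ k) u ≡ dot c u − dot c′ u
  dot-difference c c′ u = trans (sum-cong-≗ (λ k → cong (λ z → (c k + - z) * u k) (sym (*-identityˡ (c′ k)))))
                          (trans (dot-linear c c′ 1ℝ u) (cong (λ z → dot c u + - z) (*-identityˡ (dot c′ u))))

  dot-combination : ∀ {N} α β (e₁ e₀ f₁ f₀ u : Fin N → ℝ) →
    dot (λ k → α * (e₁ k + - e₀ k) + β * (f₁ k + - f₀ k)) u ≡ α * (dot e₁ u − dot e₀ u) + β * (dot f₁ u − dot f₀ u)
  dot-combination α β e₁ e₀ f₁ f₀ u = begin
      dot (λ k → α * (e₁ k + - e₀ k) + β * (f₁ k + - f₀ k)) u
        ≡⟨ dot-+ (λ k → α * (e₁ k + - e₀ k)) (λ k → β * (f₁ k + - f₀ k)) u ⟩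
      dot (λ k → α * (e₁ k + - e₀ k)) u + dot (λ k → β * (f₁ k + - f₀ k)) u
        ≡⟨ cong₂ _+_ (dot-scale α (λ k → e₁ k + - e₀ k) u) (dot-scale β (λ k → f₁ k + - f₀ k) u) ⟩
      α * dot (λ k → e₁ k + - e₀ k) u + β * dot (λ k → f₁ k + - f₀ k) u
        ≡⟨ cong₂ (λ x y → α * x + β * y) (dot-difference e₁ e₀ u) (dot-difference f₁ f₀ u) ⟩
      α * (dot e₁ u − dot e₀ u) + β * (dot f₁ u − dot f₀ u) ∎
    where open ≡-Reasoning

  difference-equation : ∀ {N} → QS → Fin N → Fin N → QS → Fin N → Fin N → QS → Equation N
  difference-equation α i₁ i₀ β j₁ j₀ r = (λ k → α ⊗ (unit i₁ k ⊕ ⊝ unit i₀ k) ⊕ β ⊗ (unit j₁ k ⊕ ⊝ unit j₀ k)) ≐ r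

  holds₊-difference : ∀ {N} α (i₁ i₀ : Fin N) β j₁ j₀ r u →
    σ₊ α * (u i₁ − u i₀) + σ₊ β * (u j₁ − u j₀) ≡ σ₊ r → Holds₊ (difference-equation α i₁ i₀ β j₁ j₀ r) u
  holds₊-difference α i₁ i₀ β j₁ j₀ r u eq =
    trans (dot-combination (σ₊ α) (σ₊ β) _ _ _ _ u)
          (trans (cong₂ (λ x y → σ₊ α * x + σ₊ β * y) (cong₂ _−_ (dot-unit i₁ u) (dot-unit i₀ u)) (cong₂ _−_ (dot-unit j₁ u) (dot-unit j₀ u))) eq)

  holds₋-difference : ∀ {N} α (i₁ i₀ : Fin N) β j₁ j₀ r u → Holds₋ (difference-equation α i₁ i₀ β j₁ j₀ r) u →
    σ₋ α * (u i₁ − u i₀) + σ₋ β * (u j₁ − u j₀) ≡ σ₋ r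
  holds₋-difference α i₁ i₀ β j₁ j₀ r u holds =
    trans (sym (cong₂ (λ x y → σ₋ α * x + σ₋ β * y) (cong₂ _−_ (dot-unit₋ i₁ u) (dot-unit₋ i₀ u)) (cong₂ _−_ (dot-unit₋ j₁ u) (dot-unit₋ j₀ u))))
          (trans (sym (dot-combination (σ₋ α) (σ₋ β) _ _ _ _ u)) holds)

  position-of : (P : List ℝ) → ℝ → Maybe (Fin (length P))
  position-of [] x = nothing
  position-of (y ∷ P) x with x ≟ y
  ... | yes _ = just zero
  ... | no _ = Maybe.map suc (position-of P x)

  position-of-∈ : ∀ {x} P → x ∈ P → ∃ λ i → position-of P x ≡ just i × lookup P i ≡ x
  position-of-∈ {x} (y ∷ P) x∈ with x ≟ y
  ... | yes x≡y = zero , refl , sym x≡y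
  position-of-∈ {x} (y ∷ P) (here x≡y) | no x≢y = ⊥-elim (x≢y x≡y)
  position-of-∈ {x} (y ∷ P) (there x∈) | no x≢y with position-of-∈ P x∈
  ... | i , found , at-i = suc i , cong (Maybe.map suc) found , at-i

  -- 1 − s < 0: the conjugate of the aspect ratio 1 + s is negative.
  1-s<0 : 0ℝ < s → 1ℝ + - s < 0ℝ
  1-s<0 0<s = subst (_< 0ℝ) (solve 1 (λ s → :- (s :- con ℤ.1ℤ) := con ℤ.1ℤ :+ (:- s)) refl s) (pos-neg (sub-pos 1<s))
    where
    1<s : 1ℝ < s
    1<s with compare 1ℝ s
    ... | tri< 1<s _ _ = 1<s
    ... | tri≈ _ refl _ = ⊥-elim (<⇒≢ 1<2 (trans (sym (*-identityˡ 1ℝ)) s²≡2))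
    ... | tri> _ _ s<1 = ⊥-elim (<-irrefl two (subst (_< two) s²≡2 (<-trans (s * s) 1ℝ two (<-trans (s * s) s 1ℝ s²<s s<1) 1<2)))
      where
      s²<s : s * s < s
      s²<s = subst (s * s <_) (*-identityʳ s) (*-monoˡ-< 0<s s<1)

  ratio-equation₁ : ∀ {Δx Δy} c → Δx ≡ c * Δy → 1ℝ * Δx + (- c) * Δy ≡ 0ℝ
  ratio-equation₁ {Δx} {Δy} c Δx≡cΔy = trans (cong (λ z → 1ℝ * z + (- c) * Δy) Δx≡cΔy)
    (solve 2 (λ c y → con ℤ.1ℤ :* (c :* y) :+ (:- c) :* y := con ℤ.0ℤ) refl c Δy)

  ratio-equation₂ : ∀ {Δx Δy} c → c * Δx ≡ Δy → c * Δx + (- 1ℝ) * Δy ≡ 0ℝ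
  ratio-equation₂ {Δx} {Δy} c cΔx≡Δy = trans (cong (λ z → c * Δx + (- 1ℝ) * z) (sym cΔx≡Δy))
    (solve 2 (λ c x → c :* x :+ (:- con ℤ.1ℤ) :* (c :* x) := con ℤ.0ℤ) refl c Δx)

  ratio-product₁ : ∀ {Δx Δy} c → 1ℝ * Δx + (- c) * Δy ≡ 0ℝ → Δx * Δy ≡ c * (Δy * Δy)
  ratio-product₁ {Δx} {Δy} c eq = begin
      Δx * Δy                                           ≡⟨ solve 3 (λ x y c → x :* y := (con ℤ.1ℤ :* x :+ (:- c) :* y) :* y :+ c :* (y :* y)) refl Δx Δy c ⟩
      (1ℝ * Δx + (- c) * Δy) * Δy + c * (Δy * Δy)       ≡⟨ cong (λ z → z * Δy + c * (Δy * Δy)) eq ⟩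
      0ℝ * Δy + c * (Δy * Δy)                           ≡⟨ solve 2 (λ y c → con ℤ.0ℤ :* y :+ c :* (y :* y) := c :* (y :* y)) refl Δy c ⟩
      c * (Δy * Δy)                                     ∎
    where open ≡-Reasoning

  ratio-product₂ : ∀ {Δx Δy} c → c * Δx + (- 1ℝ) * Δy ≡ 0ℝ → Δx * Δy ≡ c * (Δx * Δx)
  ratio-product₂ {Δx} {Δy} c eq = begin
      Δx * Δy                                           ≡⟨ solve 3 (λ x y c → x :* y := c :* (x :* x) :+ (:- x) :* (c :* x :+ (:- con ℤ.1ℤ) :* y)) refl Δx Δy c ⟩
      c * (Δx * Δx) + (- Δx) * (c * Δx + (- 1ℝ) * Δy)   ≡⟨ cong (λ z → c * (Δx * Δx) + (- Δx) * z) eq ⟩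
      c * (Δx * Δx) + (- Δx) * 0ℝ                       ≡⟨ solve 2 (λ x c → c :* (x :* x) :+ (:- x) :* con ℤ.0ℤ := c :* (x :* x)) refl Δx c ⟩
      c * (Δx * Δx)                                     ∎
    where open ≡-Reasoning

  scale-equation : ∀ α β x₁ x₀ y₁ y₀ e → α * (x₁ − x₀) + β * (y₁ − y₀) ≡ 0ℝ → α * (x₁ * e − x₀ * e) + β * (y₁ * e − y₀ * e) ≡ 0ℝ
  scale-equation α β x₁ x₀ y₁ y₀ e eq = begin
      α * (x₁ * e − x₀ * e) + β * (y₁ * e − y₀ * e)   ≡⟨ solve 7 (λ α β x₁ x₀ y₁ y₀ e → α :* (x₁ :* e :- x₀ :* e) :+ β :* (y₁ :* e :- y₀ :* e) := (α :* (x₁ :- x₀) :+ β :* (y₁ :- y₀)) :* e) refl α β x₁ x₀ y₁ y₀ e ⟩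
      (α * (x₁ − x₀) + β * (y₁ − y₀)) * e             ≡⟨ cong (_* e) eq ⟩
      0ℝ * e                                          ≡⟨ zeroˡ e ⟩
      0ℝ                                              ∎
    where open ≡-Reasoning

  module Tiled {rs : List (Rect R)} {a b d : ℝ} (0<d : 0ℝ < d)
               (ratios : ∀ i → HasRatio R (1ℝ + s) (lookup rs i)) where

    -- One unknown per grid line.
    G : List ℝ
    G = tiling-grid rs a b d

    N : ℕ
    N = length G

    position : ∀ {x} → x ∈ G → Fin N
    position x∈ = proj₁ (position-of-∈ G x∈)

    -- the real solution: each grid line at its coordinate divided by d
    d⁻¹ : ℝ
    d⁻¹ = proj₁ (*-inverse d (λ d≡0 → <⇒≢ 0<d (sym d≡0)))

    scaled : Fin N → ℝ
    scaled k = lookup G k * d⁻¹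

    scaled-position : ∀ {x} (x∈ : x ∈ G) → scaled (position x∈) ≡ x * d⁻¹
    scaled-position x∈ = cong (_* d⁻¹) (proj₂ (proj₂ (position-of-∈ G x∈)))

    side-equation : ∀ {x₀ x₁} → x₀ ∈ G → x₁ ∈ G → Equation N
    side-equation x₀∈ x₁∈ = difference-equation 𝟙 (position x₁∈) (position x₀∈) 𝟘 (position x₁∈) (position x₀∈) 𝟙

    tile-equation : ∀ i → HasRatio R (1ℝ + s) (lookup rs i) → Equation N
    tile-equation i (inj₁ _) = difference-equation 𝟙 (position x₁∈) (position x₀∈) (⊝ ρ) (position y₁∈) (position y₀∈) 𝟘
      where open OnGrid (tile-on-grid rs a b d i)
    tile-equation i (inj₂ _) = difference-equation ρ (position x₁∈) (position x₀∈) (⊝ 𝟙) (position y₁∈) (position y₀∈) 𝟘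
      where open OnGrid (tile-on-grid rs a b d i)

    system : Fin (suc (suc (length rs))) → Equation N
    system zero = side-equation x₀∈ x₁∈ where open OnGrid (square-on-grid rs a b d)
    system (suc zero) = side-equation y₀∈ y₁∈ where open OnGrid (square-on-grid rs a b d)
    system (suc (suc i)) = tile-equation i (ratios i)

    side-holds : ∀ {x} (x∈ : x ∈ G) (x+d∈ : x + d ∈ G) → Holds₊ (side-equation x∈ x+d∈) scaled
    side-holds {x} x∈ x+d∈ = holds₊-difference 𝟙 _ _ 𝟘 _ _ 𝟙 scaled (begin
        1ℝ * (scaled p₁ − scaled p₀) + 0ℝ * (scaled p₁ − scaled p₀)
          ≡⟨ cong (λ z → 1ℝ * z + 0ℝ * z) (cong₂ _−_ (scaled-position x+d∈) (scaled-position x∈)) ⟩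
        1ℝ * ((x + d) * d⁻¹ − x * d⁻¹) + 0ℝ * ((x + d) * d⁻¹ − x * d⁻¹)
          ≡⟨ solve 3 (λ x d e → con ℤ.1ℤ :* ((x :+ d) :* e :- x :* e) :+ con ℤ.0ℤ :* ((x :+ d) :* e :- x :* e) := e :* d) refl x d d⁻¹ ⟩
        d⁻¹ * d
          ≡⟨ proj₂ (*-inverse d (λ d≡0 → <⇒≢ 0<d (sym d≡0))) ⟩
        1ℝ ∎)
      where
      open ≡-Reasoning
      p₀ p₁ : Fin N
      p₀ = position x∈
      p₁ = position x+d∈

    tile-holds : ∀ i (h : HasRatio R (1ℝ + s) (lookup rs i)) → Holds₊ (tile-equation i h) scaled
    tile-holds i (inj₁ w≡ρh) = holds₊-difference 𝟙 _ _ (⊝ ρ) _ _ 𝟘 scaled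
      (trans (cong₂ (λ u v → 1ℝ * u + (- (1ℝ + s)) * v) (cong₂ _−_ (scaled-position x₁∈) (scaled-position x₀∈)) (cong₂ _−_ (scaled-position y₁∈) (scaled-position y₀∈)))
             (scale-equation _ _ _ _ _ _ d⁻¹ (ratio-equation₁ (1ℝ + s) w≡ρh)))
      where open OnGrid (tile-on-grid rs a b d i)
    tile-holds i (inj₂ ρw≡h) = holds₊-difference ρ _ _ (⊝ 𝟙) _ _ 𝟘 scaled
      (trans (cong₂ (λ u v → (1ℝ + s) * u + (- 1ℝ) * v) (cong₂ _−_ (scaled-position x₁∈) (scaled-position x₀∈)) (cong₂ _−_ (scaled-position y₁∈) (scaled-position y₀∈)))
             (scale-equation _ _ _ _ _ _ d⁻¹ (ratio-equation₂ (1ℝ + s) ρw≡h)))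
      where open OnGrid (tile-on-grid rs a b d i)

    system-holds : ∀ e → Holds₊ (system e) scaled
    system-holds zero = side-holds (OnGrid.x₀∈ (square-on-grid rs a b d)) (OnGrid.x₁∈ (square-on-grid rs a b d))
    system-holds (suc zero) = side-holds (OnGrid.y₀∈ (square-on-grid rs a b d)) (OnGrid.y₁∈ (square-on-grid rs a b d))
    system-holds (suc (suc i)) = tile-holds i (ratios i)

    -- A solution of the conjugate system, read as a function φ on the grid lines.
    conjugate : ∃ λ w → ∀ e → Holds₋ (system e) w
    conjugate = conjugate-solution N system scaled system-holds

    φ : ℝ → ℝ
    φ x = maybe (proj₁ conjugate) 0ℝ (position-of G x)

    φ-position : ∀ {x} (x∈ : x ∈ G) → proj₁ conjugate (position x∈) ≡ φ x
    φ-position x∈ = sym (cong (maybe (proj₁ conjugate) 0ℝ) (proj₁ (proj₂ (position-of-∈ G x∈))))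

    -- In the conjugate world the square still has φ-width and φ-height 1 ...
    side-increment : ∀ {x} (x∈ : x ∈ G) (x+d∈ : x + d ∈ G) → Holds₋ (side-equation x∈ x+d∈) (proj₁ conjugate) → φ (x + d) − φ x ≡ 1ℝ
    side-increment {x} x∈ x+d∈ holds = begin
        φ (x + d) − φ x                    ≡⟨ solve 1 (λ Δ → Δ := con ℤ.1ℤ :* Δ :+ con ℤ.0ℤ :* Δ) refl (φ (x + d) − φ x) ⟩
        1ℝ * Δ + 0ℝ * Δ                    ≡⟨ cong (λ z → 1ℝ * z + 0ℝ * z) (sym (cong₂ _−_ (φ-position x+d∈) (φ-position x∈))) ⟩
        1ℝ * Δw + 0ℝ * Δw                  ≡⟨ holds₋-difference 𝟙 _ _ 𝟘 _ _ 𝟙 (proj₁ conjugate) holds ⟩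
        1ℝ                                 ∎
      where
      open ≡-Reasoning
      Δ Δw : ℝ
      Δ = φ (x + d) − φ x
      Δw = proj₁ conjugate (position x+d∈) − proj₁ conjugate (position x∈)

    square-area : area φ φ (square R a b d) ≡ 1ℝ
    square-area = trans (cong₂ _*_ (side-increment x₀∈ x₁∈ (proj₂ conjugate zero)) (side-increment y₀∈ y₁∈ (proj₂ conjugate (suc zero))))
                        (*-identityˡ 1ℝ)
      where open OnGrid (square-on-grid rs a b d)

    -- ... while every tile has φ-area (1 − s)·(square) ≤ 0.
    tile-area : ∀ i (h : HasRatio R (1ℝ + s) (lookup rs i)) → Holds₋ (tile-equation i h) (proj₁ conjugate) → 0ℝ < s → area φ φ (lookup rs i) ≤ 0ℝ
    tile-area i (inj₁ _) holds 0<s = subst (_≤ 0ℝ) (sym (ratio-product₁ (1ℝ + - s) balance)) (neg-*-nonneg (1-s<0 0<s) (square-nonneg _))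
      where
      open OnGrid (tile-on-grid rs a b d i)
      balance : 1ℝ * (φ (x₁ (lookup rs i)) − φ (x₀ (lookup rs i))) + (- (1ℝ + - s)) * (φ (y₁ (lookup rs i)) − φ (y₀ (lookup rs i))) ≡ 0ℝ
      balance = subst₂ (λ u v → 1ℝ * u + (- (1ℝ + - s)) * v ≡ 0ℝ) (cong₂ _−_ (φ-position x₁∈) (φ-position x₀∈)) (cong₂ _−_ (φ-position y₁∈) (φ-position y₀∈))
                  (holds₋-difference 𝟙 _ _ (⊝ ρ) _ _ 𝟘 (proj₁ conjugate) holds)
    tile-area i (inj₂ _) holds 0<s = subst (_≤ 0ℝ) (sym (ratio-product₂ (1ℝ + - s) balance)) (neg-*-nonneg (1-s<0 0<s) (square-nonneg _))
      where
      open OnGrid (tile-on-grid rs a b d i)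
      balance : (1ℝ + - s) * (φ (x₁ (lookup rs i)) − φ (x₀ (lookup rs i))) + (- 1ℝ) * (φ (y₁ (lookup rs i)) − φ (y₀ (lookup rs i))) ≡ 0ℝ
      balance = subst₂ (λ u v → (1ℝ + - s) * u + (- 1ℝ) * v ≡ 0ℝ) (cong₂ _−_ (φ-position x₁∈) (φ-position x₀∈)) (cong₂ _−_ (φ-position y₁∈) (φ-position y₀∈))
                  (holds₋-difference ρ _ _ (⊝ 𝟙) _ _ 𝟘 (proj₁ conjugate) holds)

mainTheorem2 : (R : RealField) → let open RealField R in
    (s : ℝ) → 0ℝ < s → s * s ≡ 1ℝ + 1ℝ →
    (a b d : ℝ) → 0ℝ < d →
    ¬ (Σ (List (Rect R)) λ rs → Tiles R rs a b d
    × (∀ i → HasRatio R (1ℝ + s) (lookup rs i)))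
mainTheorem2 R s 0<s s²≡2 a b d 0<d (rs , tiling , ratios) =
  <⇒¬≥ 0<1 (subst (_≤ 0ℝ) total-area (sum-nonpos (λ i → area φ φ (lookup rs i)) tile-nonpos))
  where
  open import Data.Fin using (suc)
  open OrderedField R
  open Telescoping R using (sum-nonpos)
  open Additivity R using (area; tiling-additive)
  open TilingSystem R s s²≡2
  open Tiled {rs} {a} {b} {d} 0<d ratios

  total-area : sum (λ i → area φ φ (lookup rs i)) ≡ 1ℝ
  total-area = trans (tiling-additive {rs} {a} {b} {d} 0<d tiling φ φ) square-area

  tile-nonpos : ∀ i → area φ φ (lookup rs i) ≤ 0ℝ
  tile-nonpos i = tile-area i (ratios i) (proj₂ conjugate (suc (suc i))) 0<s
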